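{- Let $\alpha$ be a positive integer. For $n\ge 1$ set \[ a_n=\sum_{i=0}^{n}\binom{2n+i}{2n-2i}3^{3i}\alpha^{2n+i}(\alpha+1)^{2n-2i},\qquad b_n=\sum_{i=0}^{n-1}\binom{2n+i}{2n-2i-1}3^{3i+1}\alpha^{2n+i}(\alpha+1)^{2n-2i-1}. \] Then \[ \lim_{n\to\infty}\left(1+\frac{\alpha-1}{\dfrac{a_n}{b_n}+1}\right)=\alpha^{1/3}. \] -}

module Defs where

open import Data.Nat as ℕ using (ℕ; zero; suc; _+_; _*_; _∸_; _^_)
open import Data.Nat.Combinatorics using (_C_)
open import Data.Integer using (+_)
open import Data.Rational as ℚ using (ℚ; 0ℚ; _≟_; _÷_; ≢-nonZero)
open import Relation.Nullary using (yes; no)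

sumTo : ℕ → (ℕ → ℕ) → ℕ
sumTo zero    f = f 0
sumTo (suc n) f = sumTo n f + f (suc n)

sumBelow : ℕ → (ℕ → ℕ) → ℕ
sumBelow zero    f = 0
sumBelow (suc n) f = sumBelow n f + f n

aSeq : ℕ → ℕ → ℕ
aSeq α n = sumTo n λ i →
  ((2 * n + i) C (2 * n ∸ 2 * i)) * 3 ^ (3 * i) * α ^ (2 * n + i) * (α + 1) ^ (2 * n ∸ 2 * i)

bSeq : ℕ → ℕ → ℕ
bSeq α n = sumBelow n λ i →
  ((2 * n + i) C (2 * n ∸ 2 * i ∸ 1)) * 3 ^ (3 * i + 1) * α ^ (2 * n + i) * (α + 1) ^ (2 * n ∸ 2 * i ∸ 1)

toℚ : ℕ → ℚ
toℚ m = (+ m) ℚ./ 1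

-- division of rationals, with the (never used for the relevant n) convention p / 0 = 0
_÷'_ : ℚ → ℚ → ℚ
p ÷' q with q ≟ 0ℚ
... | yes _  = 0ℚ
... | no q≢0 = _÷_ p q {{≢-nonZero q≢0}}

xSeq : ℕ → ℕ → ℚ
xSeq α n = ℚ.1ℚ ℚ.+ ((toℚ α ℚ.- ℚ.1ℚ) ÷' ((toℚ (aSeq α n) ÷' toℚ (bSeq α n)) ℚ.+ ℚ.1ℚ))

cube : ℚ → ℚ
cube q = q ℚ.* q ℚ.* q

module Submission where

-- Write (1 + θ)^m = u + vθ + wθ² with θ³ = α. The conjugates 1 + θω, 1 + θω² are smaller than
-- 1 + θ, so the coefficients of their product, the cofactors u² − αvw, αw² − uv, v² − uw, become
-- negligible against uv, uw, vw; since u³ − αv³ = u (u² − αvw) − αv (v² − uw), the ratio u / v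
-- tends to θ. Pascal's rule identifies a_n + α b_n and a_n + b_n with α^{2n} u and α^{2n} v for
-- m = 6n + 1, and x_n = (a_n + α b_n) / (a_n + b_n). Finally 4(x ∓ ε)³ ± ε³ ± 3ε(2x ∓ ε)² = 4x³
-- turns a small cube defect 4 ∣x³ − α∣ < ε³ into (x − ε)³ < α < (x + ε)³.

open import Defs

module PowersOf1+θ where

  open import Data.Nat using (ℕ; zero; suc; _+_; _*_; _^_; _≤_; _<_; z≤n; s≤s; NonZero)
  open import Data.Nat.Properties
  open import Data.Nat.Tactic.RingSolver using (solve-∀)
  open import Data.Integer as ℤ using (ℤ; +_; ∣_∣; -1ℤ)
  import Data.Integer.Properties as ℤ
  import Data.Integer.Tactic.RingSolver as ℤ
  open import Data.Product using (_×_; _,_; proj₁; proj₂)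
  open import Relation.Binary.PropositionalEquality

  open ≤-Reasoning

  -- ⟨ u , v , w ⟩ stands for u + vθ + wθ² in ℕ[θ], where θ³ = α.
  record Triple : Set where
    constructor ⟨_,_,_⟩
    field
      u v w : ℕ

  mul1+θ : ℕ → Triple → Triple
  mul1+θ α ⟨ u , v , w ⟩ = ⟨ u + α * w , u + v , v + w ⟩

  pow1+θ : ℕ → ℕ → Triple
  pow1+θ α zero    = ⟨ 1 , 0 , 0 ⟩
  pow1+θ α (suc m) = mul1+θ α (pow1+θ α m)

  Balanced : ℕ → Triple → Set
  Balanced α ⟨ u , v , w ⟩ =
    v ≤ 2 * u × u ≤ 2 * α * v × w ≤ 2 * v × v ≤ 2 * α * w × u ≤ 2 * α * w × w ≤ 2 * u

  mul1+θ-balanced : ∀ {α} → 1 ≤ α → ∀ t → Balanced α t → Balanced α (mul1+θ α t)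
  mul1+θ-balanced {α} 1≤α ⟨ u , v , w ⟩ (v≤2u , u≤2αv , w≤2v , v≤2αw , u≤2αw , w≤2u) =
    new₁ , new₂ , new₃ , new₄ , new₅ , new₆
    where
    x≤αx : ∀ x → x ≤ α * x
    x≤αx x = subst (_≤ α * x) (*-identityˡ x) (*-monoˡ-≤ x 1≤α)
    x≤2αx : ∀ x → x ≤ α * x + α * x
    x≤2αx x = ≤-trans (x≤αx x) (m≤m+n (α * x) (α * x))
    new₁ : u + v ≤ 2 * (u + α * w)
    new₁ = begin
      u + v               ≤⟨ +-mono-≤ u≤2αw v≤2u ⟩
      2 * α * w + 2 * u   ≡⟨ lem α u w ⟩
      2 * (u + α * w)     ∎
      where lem : ∀ α u w → 2 * α * w + 2 * u ≡ 2 * (u + α * w)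
            lem = solve-∀
    new₂ : u + α * w ≤ 2 * α * (u + v)
    new₂ = begin
      u + α * w                 ≤⟨ +-mono-≤ u≤2αv (*-monoʳ-≤ α w≤2u) ⟩
      2 * α * v + α * (2 * u)   ≡⟨ lem α u v ⟩
      2 * α * (u + v)           ∎
      where lem : ∀ α u v → 2 * α * v + α * (2 * u) ≡ 2 * α * (u + v)
            lem = solve-∀
    new₃ : v + w ≤ 2 * (u + v)
    new₃ = begin
      v + w           ≤⟨ +-mono-≤ v≤2u w≤2v ⟩
      2 * u + 2 * v   ≡⟨ *-distribˡ-+ 2 u v ⟨
      2 * (u + v)     ∎
    new₄ : u + v ≤ 2 * α * (v + w)
    new₄ = begin
      u + v                         ≤⟨ +-mono-≤ u≤2αw (x≤2αx v) ⟩
      2 * α * w + (α * v + α * v)   ≡⟨ lem α v w ⟩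
      2 * α * (v + w)               ∎
      where lem : ∀ α v w → 2 * α * w + (α * v + α * v) ≡ 2 * α * (v + w)
            lem = solve-∀
    new₅ : u + α * w ≤ 2 * α * (v + w)
    new₅ = begin
      u + α * w                     ≤⟨ +-mono-≤ u≤2αv (m≤n+m (α * w) (α * w)) ⟩
      2 * α * v + (α * w + α * w)   ≡⟨ lem α v w ⟩
      2 * α * (v + w)               ∎
      where lem : ∀ α v w → 2 * α * v + (α * w + α * w) ≡ 2 * α * (v + w)
            lem = solve-∀
    new₆ : v + w ≤ 2 * (u + α * w)
    new₆ = begin
      v + w                     ≤⟨ +-mono-≤ v≤2u (x≤2αx w) ⟩
      2 * u + (α * w + α * w)   ≡⟨ lem α u w ⟩
      2 * (u + α * w)           ∎
      where lem : ∀ α u w → 2 * u + (α * w + α * w) ≡ 2 * (u + α * w)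
            lem = solve-∀

  -- The coefficients of the product of the two other conjugates of u + vθ + wθ²,
  -- so that multiplying by 1 + θ multiplies them by (1 + θω)(1 + θω²) = 1 − θ + θ².
  cof₁ cof₂ cof₃ : ℤ → ℤ → ℤ → ℤ → ℤ
  cof₁ a u v w = u ℤ.* u ℤ.- a ℤ.* (v ℤ.* w)
  cof₂ a u v w = a ℤ.* (w ℤ.* w) ℤ.- u ℤ.* v
  cof₃ a u v w = v ℤ.* v ℤ.- u ℤ.* w

  ∣cof₁∣ ∣cof₂∣ ∣cof₃∣ : ℕ → Triple → ℕ
  ∣cof₁∣ α ⟨ u , v , w ⟩ = ∣ cof₁ (+ α) (+ u) (+ v) (+ w) ∣
  ∣cof₂∣ α ⟨ u , v , w ⟩ = ∣ cof₂ (+ α) (+ u) (+ v) (+ w) ∣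
  ∣cof₃∣ α ⟨ u , v , w ⟩ = ∣ cof₃ (+ α) (+ u) (+ v) (+ w) ∣

  -- The ratio bounds ∣cof₁∣ / uv, ∣cof₂∣ / uw, ∣cof₃∣ / vw ≤ h / g, cleared of denominators.
  CofactorBound : ℕ → ℕ → ℕ → Triple → Set
  CofactorBound α g h t@(⟨ u , v , w ⟩) =
    g * ∣cof₁∣ α t ≤ h * (u * v) × g * ∣cof₂∣ α t ≤ h * (u * w) × g * ∣cof₃∣ α t ≤ h * (v * w)

  ∣lin₃∣≤ : ∀ a b c x y z →
    ∣ a ℤ.* x ℤ.+ b ℤ.* y ℤ.+ c ℤ.* z ∣ ≤ ∣ a ∣ * ∣ x ∣ + ∣ b ∣ * ∣ y ∣ + ∣ c ∣ * ∣ z ∣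
  ∣lin₃∣≤ a b c x y z = begin
    ∣ a ℤ.* x ℤ.+ b ℤ.* y ℤ.+ c ℤ.* z ∣                 ≤⟨ ℤ.∣i+j∣≤∣i∣+∣j∣ (a ℤ.* x ℤ.+ b ℤ.* y) (c ℤ.* z) ⟩
    ∣ a ℤ.* x ℤ.+ b ℤ.* y ∣ + ∣ c ℤ.* z ∣               ≤⟨ +-monoˡ-≤ _ (ℤ.∣i+j∣≤∣i∣+∣j∣ (a ℤ.* x) (b ℤ.* y)) ⟩
    ∣ a ℤ.* x ∣ + ∣ b ℤ.* y ∣ + ∣ c ℤ.* z ∣             ≡⟨ cong₂ _+_ (cong₂ _+_ (ℤ.∣i*j∣≡∣i∣*∣j∣ a x) (ℤ.∣i*j∣≡∣i∣*∣j∣ b y)) (ℤ.∣i*j∣≡∣i∣*∣j∣ c z) ⟩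
    ∣ a ∣ * ∣ x ∣ + ∣ b ∣ * ∣ y ∣ + ∣ c ∣ * ∣ z ∣     ∎

  lift-mul1+θ : ∀ (f : ℤ → ℤ → ℤ → ℤ → ℤ) α u v w →
    f (+ α) (+ (u + α * w)) (+ (u + v)) (+ (v + w)) ≡ f (+ α) (+ u ℤ.+ + α ℤ.* + w) (+ u ℤ.+ + v) (+ v ℤ.+ + w)
  lift-mul1+θ f α u v w =
    cong₃ (f (+ α)) (trans (ℤ.pos-+ u (α * w)) (cong (ℤ._+_ (+ u)) (ℤ.pos-* α w))) (ℤ.pos-+ u v) (ℤ.pos-+ v w)
    where
    cong₃ : ∀ (g : ℤ → ℤ → ℤ → ℤ) {x x′ y y′ z z′} → x ≡ x′ → y ≡ y′ → z ≡ z′ → g x y z ≡ g x′ y′ z′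
    cong₃ g refl refl refl = refl

  ∣cof₁∣-mul1+θ : ∀ α t → ∣cof₁∣ α (mul1+θ α t) ≤ 1 * ∣cof₁∣ α t + α * ∣cof₂∣ α t + α * ∣cof₃∣ α t
  ∣cof₁∣-mul1+θ α ⟨ u , v , w ⟩ = begin
    ∣ cof₁ A (+ (u + α * w)) (+ (u + v)) (+ (v + w)) ∣   ≡⟨ cong ∣_∣ (trans (lift-mul1+θ cof₁ α u v w) (identity A (+ u) (+ v) (+ w))) ⟩
    ∣ + 1 ℤ.* x ℤ.+ A ℤ.* y ℤ.+ (ℤ.- A) ℤ.* z ∣           ≤⟨ ∣lin₃∣≤ (+ 1) A (ℤ.- A) x y z ⟩
    1 * ∣ x ∣ + α * ∣ y ∣ + ∣ ℤ.- A ∣ * ∣ z ∣             ≡⟨ cong (λ c → 1 * ∣ x ∣ + α * ∣ y ∣ + c * ∣ z ∣) (ℤ.∣-i∣≡∣i∣ A) ⟩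
    1 * ∣ x ∣ + α * ∣ y ∣ + α * ∣ z ∣                     ∎
    where
    A = + α
    x = cof₁ A (+ u) (+ v) (+ w)
    y = cof₂ A (+ u) (+ v) (+ w)
    z = cof₃ A (+ u) (+ v) (+ w)
    identity : ∀ a u v w →
      (u ℤ.+ a ℤ.* w) ℤ.* (u ℤ.+ a ℤ.* w) ℤ.- a ℤ.* ((u ℤ.+ v) ℤ.* (v ℤ.+ w))
        ≡ + 1 ℤ.* (u ℤ.* u ℤ.- a ℤ.* (v ℤ.* w)) ℤ.+ a ℤ.* (a ℤ.* (w ℤ.* w) ℤ.- u ℤ.* v)
          ℤ.+ (ℤ.- a) ℤ.* (v ℤ.* v ℤ.- u ℤ.* w)
    identity = ℤ.solve-∀

  ∣cof₂∣-mul1+θ : ∀ α t → ∣cof₂∣ α (mul1+θ α t) ≤ 1 * ∣cof₁∣ α t + 1 * ∣cof₂∣ α t + α * ∣cof₃∣ α t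
  ∣cof₂∣-mul1+θ α ⟨ u , v , w ⟩ = begin
    ∣ cof₂ A (+ (u + α * w)) (+ (u + v)) (+ (v + w)) ∣   ≡⟨ cong ∣_∣ (trans (lift-mul1+θ cof₂ α u v w) (identity A (+ u) (+ v) (+ w))) ⟩
    ∣ -1ℤ ℤ.* x ℤ.+ + 1 ℤ.* y ℤ.+ A ℤ.* z ∣               ≤⟨ ∣lin₃∣≤ -1ℤ (+ 1) A x y z ⟩
    1 * ∣ x ∣ + 1 * ∣ y ∣ + α * ∣ z ∣                     ∎
    where
    A = + α
    x = cof₁ A (+ u) (+ v) (+ w)
    y = cof₂ A (+ u) (+ v) (+ w)
    z = cof₃ A (+ u) (+ v) (+ w)
    identity : ∀ a u v w →
      a ℤ.* ((v ℤ.+ w) ℤ.* (v ℤ.+ w)) ℤ.- (u ℤ.+ a ℤ.* w) ℤ.* (u ℤ.+ v)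
        ≡ -1ℤ ℤ.* (u ℤ.* u ℤ.- a ℤ.* (v ℤ.* w)) ℤ.+ + 1 ℤ.* (a ℤ.* (w ℤ.* w) ℤ.- u ℤ.* v)
          ℤ.+ a ℤ.* (v ℤ.* v ℤ.- u ℤ.* w)
    identity = ℤ.solve-∀

  ∣cof₃∣-mul1+θ : ∀ α t → ∣cof₃∣ α (mul1+θ α t) ≤ 1 * ∣cof₁∣ α t + 1 * ∣cof₂∣ α t + 1 * ∣cof₃∣ α t
  ∣cof₃∣-mul1+θ α ⟨ u , v , w ⟩ = begin
    ∣ cof₃ A (+ (u + α * w)) (+ (u + v)) (+ (v + w)) ∣   ≡⟨ cong ∣_∣ (trans (lift-mul1+θ cof₃ α u v w) (identity A (+ u) (+ v) (+ w))) ⟩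
    ∣ + 1 ℤ.* x ℤ.+ -1ℤ ℤ.* y ℤ.+ + 1 ℤ.* z ∣             ≤⟨ ∣lin₃∣≤ (+ 1) -1ℤ (+ 1) x y z ⟩
    1 * ∣ x ∣ + 1 * ∣ y ∣ + 1 * ∣ z ∣                     ∎
    where
    A = + α
    x = cof₁ A (+ u) (+ v) (+ w)
    y = cof₂ A (+ u) (+ v) (+ w)
    z = cof₃ A (+ u) (+ v) (+ w)
    identity : ∀ a u v w →
      (u ℤ.+ v) ℤ.* (u ℤ.+ v) ℤ.- (u ℤ.+ a ℤ.* w) ℤ.* (v ℤ.+ w)
        ≡ + 1 ℤ.* (u ℤ.* u ℤ.- a ℤ.* (v ℤ.* w)) ℤ.+ -1ℤ ℤ.* (a ℤ.* (w ℤ.* w) ℤ.- u ℤ.* v)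
          ℤ.+ + 1 ℤ.* (v ℤ.* v ℤ.- u ℤ.* w)
    identity = ℤ.solve-∀

  combine-bounds : ∀ {g h E x y z X Y Z} a b c → E ≤ a * x + b * y + c * z →
    g * x ≤ h * X → g * y ≤ h * Y → g * z ≤ h * Z → g * E ≤ h * (a * X + b * Y + c * Z)
  combine-bounds {g} {h} {E} {x} {y} {z} {X} {Y} {Z} a b c E≤ gx≤ gy≤ gz≤ = begin
    g * E                                        ≤⟨ *-monoʳ-≤ g E≤ ⟩
    g * (a * x + b * y + c * z)                  ≡⟨ lem₁ g a b c x y z ⟩
    a * (g * x) + b * (g * y) + c * (g * z)      ≤⟨ +-mono-≤ (+-mono-≤ (*-monoʳ-≤ a gx≤) (*-monoʳ-≤ b gy≤)) (*-monoʳ-≤ c gz≤) ⟩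
    a * (h * X) + b * (h * Y) + c * (h * Z)      ≡⟨ lem₁ h a b c X Y Z ⟨
    h * (a * X + b * Y + c * Z)                  ∎
    where
    lem₁ : ∀ g a b c x y z → g * (a * x + b * y + c * z) ≡ a * (g * x) + b * (g * y) + c * (g * z)
    lem₁ = solve-∀

  -- A product growing from S to S + Z ≥ (1 + 1/K) S improves the ratio bound h / g by K / (K + 1).
  bound-contracts : ∀ {g h E S Z} K → g * E ≤ h * S → S ≤ K * Z → suc K * g * E ≤ K * h * (S + Z)
  bound-contracts {g} {h} {E} {S} {Z} K gE≤hS S≤KZ = begin
    suc K * g * E                 ≡⟨ lem₁ K g E ⟩
    K * (g * E) + g * E           ≤⟨ +-mono-≤ (*-monoʳ-≤ K gE≤hS) gE≤hS ⟩
    K * (h * S) + h * S           ≤⟨ +-monoʳ-≤ (K * (h * S)) (*-monoʳ-≤ h S≤KZ) ⟩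
    K * (h * S) + h * (K * Z)     ≡⟨ lem₂ K h S Z ⟩
    K * h * (S + Z)               ∎
    where
    lem₁ : ∀ K g E → suc K * g * E ≡ K * (g * E) + g * E
    lem₁ = solve-∀
    lem₂ : ∀ K h S Z → K * (h * S) + h * (K * Z) ≡ K * h * (S + Z)
    lem₂ = solve-∀

  κ : ℕ → ℕ
  κ α = 2 + 6 * α

  balanced-mixed-products : ∀ {α u v w} → Balanced α ⟨ u , v , w ⟩ →
    1 * (u * v) + α * (u * w) + α * (v * w) ≤ κ α * (u * u) ×
    1 * (u * v) + 1 * (u * w) + α * (v * w) ≤ κ α * (α * (w * w)) ×
    1 * (u * v) + 1 * (u * w) + 1 * (v * w) ≤ κ α * (v * v)
  balanced-mixed-products {α} {u} {v} {w} (v≤2u , u≤2αv , w≤2v , v≤2αw , u≤2αw , w≤2u) = S₁≤ , S₂≤ , S₃≤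
    where
    S₁≤ : 1 * (u * v) + α * (u * w) + α * (v * w) ≤ κ α * (u * u)
    S₁≤ = begin
      1 * (u * v) + α * (u * w) + α * (v * w)
        ≤⟨ +-mono-≤ (+-mono-≤ (*-monoʳ-≤ 1 (*-monoʳ-≤ u v≤2u)) (*-monoʳ-≤ α (*-monoʳ-≤ u w≤2u)))
                    (*-monoʳ-≤ α (*-mono-≤ v≤2u w≤2u)) ⟩
      1 * (u * (2 * u)) + α * (u * (2 * u)) + α * ((2 * u) * (2 * u))   ≡⟨ lem α u ⟩
      κ α * (u * u)                                                      ∎
      where lem : ∀ α u → 1 * (u * (2 * u)) + α * (u * (2 * u)) + α * ((2 * u) * (2 * u)) ≡ (2 + 6 * α) * (u * u)
            lem = solve-∀
    S₂≤ : 1 * (u * v) + 1 * (u * w) + α * (v * w) ≤ κ α * (α * (w * w))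
    S₂≤ = begin
      1 * (u * v) + 1 * (u * w) + α * (v * w)
        ≤⟨ +-mono-≤ (+-mono-≤ (*-monoʳ-≤ 1 (*-mono-≤ u≤2αw v≤2αw)) (*-monoʳ-≤ 1 (*-monoˡ-≤ w u≤2αw)))
                    (*-monoʳ-≤ α (*-monoˡ-≤ w v≤2αw)) ⟩
      1 * ((2 * α * w) * (2 * α * w)) + 1 * ((2 * α * w) * w) + α * ((2 * α * w) * w)   ≡⟨ lem α w ⟩
      κ α * (α * (w * w))                                                                ∎
      where lem : ∀ α w → 1 * ((2 * α * w) * (2 * α * w)) + 1 * ((2 * α * w) * w) + α * ((2 * α * w) * w)
                            ≡ (2 + 6 * α) * (α * (w * w))
            lem = solve-∀
    S₃≤ : 1 * (u * v) + 1 * (u * w) + 1 * (v * w) ≤ κ α * (v * v)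
    S₃≤ = begin
      1 * (u * v) + 1 * (u * w) + 1 * (v * w)
        ≤⟨ +-mono-≤ (+-mono-≤ (*-monoʳ-≤ 1 (*-monoˡ-≤ v u≤2αv)) (*-monoʳ-≤ 1 (*-mono-≤ u≤2αv w≤2v)))
                    (*-monoʳ-≤ 1 (*-monoʳ-≤ v w≤2v)) ⟩
      1 * ((2 * α * v) * v) + 1 * ((2 * α * v) * (2 * v)) + 1 * (v * (2 * v))   ≡⟨ lem α v ⟩
      κ α * (v * v)                                                              ∎
      where lem : ∀ α v → 1 * ((2 * α * v) * v) + 1 * ((2 * α * v) * (2 * v)) + 1 * (v * (2 * v)) ≡ (2 + 6 * α) * (v * v)
            lem = solve-∀

  -- Each new product of coordinates is Sᵢ + q, where Sᵢ bounds the new cofactor and the square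
  -- q ∈ {u², αw², v²} is at least Sᵢ / κ.
  mul1+θ-cofactorBound : ∀ α g h t → Balanced α t → CofactorBound α g h t →
    CofactorBound α (suc (κ α) * g) (κ α * h) (mul1+θ α t)
  mul1+θ-cofactorBound α g h t@(⟨ u , v , w ⟩) balanced (b₁ , b₂ , b₃) =
    subst (suc (κ α) * g * ∣cof₁∣ α (mul1+θ α t) ≤_) (cong (κ α * h *_) (grow₁ α u v w))
      (bound-contracts {g} {h} (κ α) (combine-bounds {g} {h} 1 α α (∣cof₁∣-mul1+θ α t) b₁ b₂ b₃) S₁≤) ,
    subst (suc (κ α) * g * ∣cof₂∣ α (mul1+θ α t) ≤_) (cong (κ α * h *_) (grow₂ α u v w))
      (bound-contracts {g} {h} (κ α) (combine-bounds {g} {h} 1 1 α (∣cof₂∣-mul1+θ α t) b₁ b₂ b₃) S₂≤) ,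
    subst (suc (κ α) * g * ∣cof₃∣ α (mul1+θ α t) ≤_) (cong (κ α * h *_) (grow₃ α u v w))
      (bound-contracts {g} {h} (κ α) (combine-bounds {g} {h} 1 1 1 (∣cof₃∣-mul1+θ α t) b₁ b₂ b₃) S₃≤)
    where
    S≤ = balanced-mixed-products {α} {u} {v} {w} balanced
    S₁≤ = proj₁ S≤
    S₂≤ = proj₁ (proj₂ S≤)
    S₃≤ = proj₂ (proj₂ S≤)
    grow₁ : ∀ α u v w → 1 * (u * v) + α * (u * w) + α * (v * w) + u * u ≡ (u + α * w) * (u + v)
    grow₁ = solve-∀
    grow₂ : ∀ α u v w → 1 * (u * v) + 1 * (u * w) + α * (v * w) + α * (w * w) ≡ (u + α * w) * (v + w)
    grow₂ = solve-∀
    grow₃ : ∀ α u v w → 1 * (u * v) + 1 * (u * w) + 1 * (v * w) + v * v ≡ (u + v) * (v + w)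
    grow₃ = solve-∀

  ∣m-n∣≤m+n : ∀ m n → ∣ + m ℤ.- + n ∣ ≤ m + n
  ∣m-n∣≤m+n m n = ℤ.∣i-j∣≤∣i∣+∣j∣ (+ m) (+ n)

  pow1+θ-2 : ∀ α → pow1+θ α 2 ≡ ⟨ 1 , 2 , 1 ⟩
  pow1+θ-2 α rewrite *-zeroʳ α = refl

  balanced-⟨1,2,1⟩ : ∀ {α} → 1 ≤ α → Balanced α ⟨ 1 , 2 , 1 ⟩
  balanced-⟨1,2,1⟩ {α} 1≤α = ≤-refl , 1≤2α*2 , s≤s z≤n , 2≤2α*1 , 1≤2α*1 , s≤s z≤n
    where
    2≤2α*1 : 2 ≤ 2 * α * 1
    2≤2α*1 = subst (2 ≤_) (sym (*-identityʳ (2 * α))) (*-monoʳ-≤ 2 1≤α)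
    1≤2α*1 : 1 ≤ 2 * α * 1
    1≤2α*1 = ≤-trans (s≤s z≤n) 2≤2α*1
    1≤2α*2 : 1 ≤ 2 * α * 2
    1≤2α*2 = ≤-trans 1≤2α*1 (*-monoʳ-≤ (2 * α) (s≤s z≤n))

  cofactorBound-⟨1,2,1⟩ : ∀ {α} → 1 ≤ α → CofactorBound α 1 (4 * α) ⟨ 1 , 2 , 1 ⟩
  cofactorBound-⟨1,2,1⟩ {α} 1≤α = b₁ , b₂ , b₃
    where
    b₁ : 1 * ∣ + 1 ℤ.* + 1 ℤ.- + α ℤ.* (+ 2 ℤ.* + 1) ∣ ≤ 4 * α * (1 * 2)
    b₁ = begin
      1 * ∣ + 1 ℤ.- + α ℤ.* + 2 ∣   ≡⟨ *-identityˡ _ ⟩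
      ∣ + 1 ℤ.- + α ℤ.* + 2 ∣       ≡⟨ cong (λ z → ∣ + 1 ℤ.- z ∣) (ℤ.pos-* α 2) ⟨
      ∣ + 1 ℤ.- + (α * 2) ∣         ≤⟨ ∣m-n∣≤m+n 1 (α * 2) ⟩
      1 + α * 2                     ≤⟨ +-monoˡ-≤ (α * 2) 1≤α ⟩
      α + α * 2                     ≤⟨ m≤m+n (α + α * 2) (α * 5) ⟩
      α + α * 2 + α * 5             ≡⟨ lem α ⟩
      4 * α * (1 * 2)               ∎
      where lem : ∀ α → α + α * 2 + α * 5 ≡ 4 * α * (1 * 2)
            lem = solve-∀
    b₂ : 1 * ∣ + α ℤ.* (+ 1 ℤ.* + 1) ℤ.- + 1 ℤ.* + 2 ∣ ≤ 4 * α * (1 * 1)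
    b₂ = begin
      1 * ∣ + α ℤ.* + 1 ℤ.- + 2 ∣   ≡⟨ *-identityˡ _ ⟩
      ∣ + α ℤ.* + 1 ℤ.- + 2 ∣       ≡⟨ cong (λ z → ∣ z ℤ.- + 2 ∣) (ℤ.pos-* α 1) ⟨
      ∣ + (α * 1) ℤ.- + 2 ∣         ≤⟨ ∣m-n∣≤m+n (α * 1) 2 ⟩
      α * 1 + 2                     ≤⟨ +-monoʳ-≤ (α * 1) (*-monoʳ-≤ 2 1≤α) ⟩
      α * 1 + 2 * α                 ≤⟨ m≤n+m _ α ⟩
      α + (α * 1 + 2 * α)           ≡⟨ lem α ⟩
      4 * α * (1 * 1)               ∎
      where lem : ∀ α → α + (α * 1 + 2 * α) ≡ 4 * α * (1 * 1)
            lem = solve-∀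
    b₃ : 1 * ∣ + 2 ℤ.* + 2 ℤ.- + 1 ℤ.* + 1 ∣ ≤ 4 * α * (2 * 1)
    b₃ = begin
      3                 ≤⟨ s≤s (s≤s (s≤s z≤n)) ⟩
      8 * 1             ≤⟨ *-monoʳ-≤ 8 1≤α ⟩
      8 * α             ≡⟨ lem α ⟩
      4 * α * (2 * 1)   ∎
      where lem : ∀ α → 8 * α ≡ 4 * α * (2 * 1)
            lem = solve-∀

  pow1+θ-cofactorBound : ∀ {α} → 1 ≤ α → ∀ k →
    Balanced α (pow1+θ α (2 + k)) × CofactorBound α (suc (κ α) ^ k) (κ α ^ k * (4 * α)) (pow1+θ α (2 + k))
  pow1+θ-cofactorBound {α} 1≤α zero =
    subst (λ t → Balanced α t × CofactorBound α 1 (1 * (4 * α)) t) (sym (pow1+θ-2 α))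
      (balanced-⟨1,2,1⟩ 1≤α , subst (λ h → CofactorBound α 1 h ⟨ 1 , 2 , 1 ⟩) (sym (*-identityˡ (4 * α))) (cofactorBound-⟨1,2,1⟩ 1≤α))
  pow1+θ-cofactorBound {α} 1≤α (suc k) with pow1+θ-cofactorBound 1≤α k
  ... | balanced , bound =
    mul1+θ-balanced 1≤α t balanced ,
    subst (λ h → CofactorBound α (suc (κ α) ^ suc k) h (mul1+θ α t)) (sym (*-assoc (κ α) (κ α ^ k) (4 * α)))
      (mul1+θ-cofactorBound α (suc (κ α) ^ k) (κ α ^ k * (4 * α)) t balanced bound)
    where t = pow1+θ α (2 + k)

  cubeDefect : ℕ → ℕ → ℕ → ℕ
  cubeDefect α u v = ∣ + (u * u * u) ℤ.- + (α * (v * v * v)) ∣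

  cube-pos : ∀ u → + (u * u * u) ≡ + u ℤ.* + u ℤ.* + u
  cube-pos u = trans (ℤ.pos-* (u * u) u) (cong (ℤ._* + u) (ℤ.pos-* u u))

  cubeDefect-pos : ∀ α u v → + (u * u * u) ℤ.- + (α * (v * v * v)) ≡ + u ℤ.* + u ℤ.* + u ℤ.- + α ℤ.* (+ v ℤ.* + v ℤ.* + v)
  cubeDefect-pos α u v = cong₂ ℤ._-_ (cube-pos u) (trans (ℤ.pos-* α (v * v * v)) (cong (ℤ._*_ (+ α)) (cube-pos v)))

  cubeDefect-* : ∀ α s u v → cubeDefect α (s * u) (s * v) ≡ s * s * s * cubeDefect α u v
  cubeDefect-* α s u v = begin-equality
    ∣ + (s * u * (s * u) * (s * u)) ℤ.- + (α * (s * v * (s * v) * (s * v))) ∣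
      ≡⟨ cong ∣_∣ (trans (cubeDefect-pos α (s * u) (s * v)) (cong₂ (λ x y → x ℤ.* x ℤ.* x ℤ.- + α ℤ.* (y ℤ.* y ℤ.* y)) (ℤ.pos-* s u) (ℤ.pos-* s v))) ⟩
    ∣ S ℤ.* U ℤ.* (S ℤ.* U) ℤ.* (S ℤ.* U) ℤ.- A ℤ.* (S ℤ.* V ℤ.* (S ℤ.* V) ℤ.* (S ℤ.* V)) ∣
      ≡⟨ cong ∣_∣ (homogeneous A S U V) ⟩
    ∣ S ℤ.* S ℤ.* S ℤ.* (U ℤ.* U ℤ.* U ℤ.- A ℤ.* (V ℤ.* V ℤ.* V)) ∣
      ≡⟨ cong ∣_∣ (cong₂ ℤ._*_ (cube-pos s) (cubeDefect-pos α u v)) ⟨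
    ∣ + (s * s * s) ℤ.* (+ (u * u * u) ℤ.- + (α * (v * v * v))) ∣
      ≡⟨ ℤ.∣i*j∣≡∣i∣*∣j∣ (+ (s * s * s)) _ ⟩
    s * s * s * cubeDefect α u v ∎
    where
    A = + α
    S = + s
    U = + u
    V = + v
    homogeneous : ∀ A S U V →
      S ℤ.* U ℤ.* (S ℤ.* U) ℤ.* (S ℤ.* U) ℤ.- A ℤ.* (S ℤ.* V ℤ.* (S ℤ.* V) ℤ.* (S ℤ.* V))
        ≡ S ℤ.* S ℤ.* S ℤ.* (U ℤ.* U ℤ.* U ℤ.- A ℤ.* (V ℤ.* V ℤ.* V))
    homogeneous = ℤ.solve-∀

  cubeDefect-bound : ∀ α g h t → Balanced α t → CofactorBound α g h t →
    g * cubeDefect α (Triple.u t) (Triple.v t) ≤ h * (4 * α * α + 2 * α) * (Triple.v t * Triple.v t * Triple.v t)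
  cubeDefect-bound α g h ⟨ u , v , w ⟩ (_ , u≤2αv , w≤2v , _ , _ , _) (b₁ , _ , b₃) = begin
    g * cubeDefect α u v
      ≡⟨ cong (λ z → g * ∣ z ∣) (trans (cubeDefect-pos α u v) (identity (+ α) (+ u) (+ v) (+ w))) ⟩
    g * ∣ + u ℤ.* x ℤ.+ (ℤ.- (+ α ℤ.* + v)) ℤ.* z ∣
      ≤⟨ *-monoʳ-≤ g (ℤ.∣i+j∣≤∣i∣+∣j∣ (+ u ℤ.* x) _) ⟩
    g * (∣ + u ℤ.* x ∣ + ∣ (ℤ.- (+ α ℤ.* + v)) ℤ.* z ∣)
      ≡⟨ cong₂ (λ p q → g * (p + q)) (ℤ.∣i*j∣≡∣i∣*∣j∣ (+ u) x)
           (trans (ℤ.∣i*j∣≡∣i∣*∣j∣ (ℤ.- (+ α ℤ.* + v)) z)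
             (cong (_* ∣ z ∣) (trans (ℤ.∣-i∣≡∣i∣ (+ α ℤ.* + v)) (ℤ.∣i*j∣≡∣i∣*∣j∣ (+ α) (+ v))))) ⟩
    g * (u * ∣ x ∣ + α * v * ∣ z ∣)                           ≡⟨ lem₁ g u (∣ x ∣) α v (∣ z ∣) ⟩
    u * (g * ∣ x ∣) + α * v * (g * ∣ z ∣)                     ≤⟨ +-mono-≤ (*-monoʳ-≤ u b₁) (*-monoʳ-≤ (α * v) b₃) ⟩
    u * (h * (u * v)) + α * v * (h * (v * w))                 ≡⟨ lem₂ h u v w α ⟩
    h * (u * u * v + α * v * (v * w))
      ≤⟨ *-monoʳ-≤ h (+-mono-≤ (*-monoˡ-≤ v (*-mono-≤ u≤2αv u≤2αv)) (*-monoʳ-≤ (α * v) (*-monoʳ-≤ v w≤2v))) ⟩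
    h * (2 * α * v * (2 * α * v) * v + α * v * (v * (2 * v)))  ≡⟨ lem₃ h α v ⟩
    h * (4 * α * α + 2 * α) * (v * v * v)                      ∎
    where
    x = cof₁ (+ α) (+ u) (+ v) (+ w)
    z = cof₃ (+ α) (+ u) (+ v) (+ w)
    identity : ∀ a u v w → u ℤ.* u ℤ.* u ℤ.- a ℤ.* (v ℤ.* v ℤ.* v)
      ≡ u ℤ.* (u ℤ.* u ℤ.- a ℤ.* (v ℤ.* w)) ℤ.+ (ℤ.- (a ℤ.* v)) ℤ.* (v ℤ.* v ℤ.- u ℤ.* w)
    identity = ℤ.solve-∀
    lem₁ : ∀ g u x α v z → g * (u * x + α * v * z) ≡ u * (g * x) + α * v * (g * z)
    lem₁ = solve-∀
    lem₂ : ∀ h u v w α → u * (h * (u * v)) + α * v * (h * (v * w)) ≡ h * (u * u * v + α * v * (v * w))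
    lem₂ = solve-∀
    lem₃ : ∀ h α v → h * (2 * α * v * (2 * α * v) * v + α * v * (v * (2 * v))) ≡ h * (4 * α * α + 2 * α) * (v * v * v)
    lem₃ = solve-∀

  -- Bernoulli's inequality (1 + 1/K)^k ≥ 1 + k/K, cleared of denominators.
  bernoulli : ∀ K k → K ^ k * (K + k) ≤ K * suc K ^ k
  bernoulli K zero = ≤-reflexive (trans (*-identityˡ (K + 0)) (trans (+-identityʳ K) (sym (*-identityʳ K))))
  bernoulli K (suc k) = begin
    K * K ^ k * (K + suc k)                     ≡⟨ lem₁ K (K ^ k) k ⟩
    K * (K ^ k * (K + k)) + K ^ k * K           ≤⟨ +-monoʳ-≤ (K * (K ^ k * (K + k))) (*-monoʳ-≤ (K ^ k) (m≤m+n K k)) ⟩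
    K * (K ^ k * (K + k)) + K ^ k * (K + k)     ≤⟨ +-mono-≤ (*-monoʳ-≤ K (bernoulli K k)) (bernoulli K k) ⟩
    K * (K * suc K ^ k) + K * suc K ^ k         ≡⟨ lem₂ K (suc K ^ k) ⟩
    K * (suc K * suc K ^ k)                     ∎
    where
    lem₁ : ∀ K P k → K * P * (K + suc k) ≡ K * (P * (K + k)) + P * K
    lem₁ = solve-∀
    lem₂ : ∀ K Q → K * (K * Q) + K * Q ≡ K * (suc K * Q)
    lem₂ = solve-∀

  cubeDefectBound : ℕ → ℕ
  cubeDefectBound α = κ α * (4 * α * (4 * α * α + 2 * α))

  -- The cofactor bounds decay like (κ / (κ + 1))^k, weakened here by Bernoulli to κ / (κ + k).
  pow1+θ-cubeDefect : ∀ {α} → 1 ≤ α → ∀ k → let t = pow1+θ α (2 + k) in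
    (κ α + k) * cubeDefect α (Triple.u t) (Triple.v t) ≤ cubeDefectBound α * (Triple.v t * Triple.v t * Triple.v t)
  pow1+θ-cubeDefect {α} 1≤α k = *-cancelˡ-≤ (K ^ k) (begin
    K ^ k * ((K + k) * E)                 ≡⟨ *-assoc (K ^ k) (K + k) E ⟨
    K ^ k * (K + k) * E                   ≤⟨ *-monoˡ-≤ E (bernoulli K k) ⟩
    K * suc K ^ k * E                     ≡⟨ *-assoc K (suc K ^ k) E ⟩
    K * (suc K ^ k * E)                   ≤⟨ *-monoʳ-≤ K (cubeDefect-bound α (suc K ^ k) (K ^ k * (4 * α)) t balanced bound) ⟩
    K * (K ^ k * (4 * α) * C * V³)        ≡⟨ lem K (K ^ k) (4 * α) C V³ ⟩
    K ^ k * (cubeDefectBound α * V³)      ∎)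
    where
    K = κ α
    C = 4 * α * α + 2 * α
    t = pow1+θ α (2 + k)
    E = cubeDefect α (Triple.u t) (Triple.v t)
    V³ = Triple.v t * Triple.v t * Triple.v t
    balanced = proj₁ (pow1+θ-cofactorBound 1≤α k)
    bound = proj₂ (pow1+θ-cofactorBound 1≤α k)
    instance
      Kᵏ≢0 : NonZero (K ^ k)
      Kᵏ≢0 = m^n≢0 K k
    lem : ∀ K Kᵏ a C V → K * (Kᵏ * a * C * V) ≡ Kᵏ * (K * (a * C) * V)
    lem = solve-∀

  pow1+θ-v-pos : ∀ α m → 0 < Triple.v (pow1+θ α (suc m))
  pow1+θ-v-pos α zero    = s≤s z≤n
  pow1+θ-v-pos α (suc m) = ≤-trans (pow1+θ-v-pos α m) (m≤n+m (Triple.v t) (Triple.u t))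
    where t = pow1+θ α (suc m)

  pow1+θ-cubeDefect-small : ∀ {α} → 1 ≤ α → ∀ c k → c * cubeDefectBound α ≤ k → let t = pow1+θ α (2 + k) in
    c * cubeDefect α (Triple.u t) (Triple.v t) < Triple.v t * Triple.v t * Triple.v t
  pow1+θ-cubeDefect-small {α} 1≤α c k cB≤k = *-cancelˡ-< (K + k) _ _ (begin-strict
    (K + k) * (c * E)      ≡⟨ lem (K + k) c E ⟩
    c * ((K + k) * E)      ≤⟨ *-monoʳ-≤ c (pow1+θ-cubeDefect 1≤α k) ⟩
    c * (B * V³)           ≡⟨ *-assoc c B V³ ⟨
    c * B * V³             ≤⟨ *-monoˡ-≤ V³ cB≤k ⟩
    k * V³                 <⟨ m<n+m (k * V³) {K * V³} (*-mono-< {0} {K} (s≤s z≤n) V³-pos) ⟩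
    K * V³ + k * V³        ≡⟨ *-distribʳ-+ V³ K k ⟨
    (K + k) * V³           ∎)
    where
    K = κ α
    B = cubeDefectBound α
    t = pow1+θ α (2 + k)
    v = Triple.v t
    E = cubeDefect α (Triple.u t) v
    V³ = v * v * v
    V³-pos : 0 < V³
    V³-pos = let v-pos = pow1+θ-v-pos α (suc k) in *-mono-< (*-mono-< v-pos v-pos) v-pos
    lem : ∀ a c E → a * (c * E) ≡ c * (a * E)
    lem = solve-∀

module BinomialSums where

  open import Data.Nat using (ℕ; zero; suc; _+_; _*_; _^_; _∸_; _≤_; _<_; _<?_; z≤n; s≤s)
  open import Data.Nat.Properties
  open import Data.Nat.Combinatorics using (_C_; k>n⇒nCk≡0; nCk+nC[k+1]≡[n+1]C[k+1]; nCk≡nC[n∸k])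
  open import Data.Nat.Tactic.RingSolver using (solve-∀)
  open import Data.Product using (_×_; _,_)
  open import Relation.Binary.PropositionalEquality
  open import Relation.Nullary using (yes; no)
  open PowersOf1+θ using (Triple; ⟨_,_,_⟩; mul1+θ; pow1+θ)

  open ≡-Reasoning

  sumTo-cong : ∀ n {f g : ℕ → ℕ} → (∀ i → i ≤ n → f i ≡ g i) → sumTo n f ≡ sumTo n g
  sumTo-cong zero    f≗g = f≗g 0 z≤n
  sumTo-cong (suc n) f≗g = cong₂ _+_ (sumTo-cong n (λ i i≤n → f≗g i (m≤n⇒m≤1+n i≤n))) (f≗g (suc n) ≤-refl)

  sumTo-linear : ∀ n a b (f g : ℕ → ℕ) → sumTo n (λ i → a * f i + b * g i) ≡ a * sumTo n f + b * sumTo n g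
  sumTo-linear zero    a b f g = refl
  sumTo-linear (suc n) a b f g = begin
    sumTo n (λ i → a * f i + b * g i) + (a * f (suc n) + b * g (suc n))
      ≡⟨ cong (_+ (a * f (suc n) + b * g (suc n))) (sumTo-linear n a b f g) ⟩
    a * sumTo n f + b * sumTo n g + (a * f (suc n) + b * g (suc n))
      ≡⟨ lem a b (sumTo n f) (sumTo n g) (f (suc n)) (g (suc n)) ⟩
    a * (sumTo n f + f (suc n)) + b * (sumTo n g + g (suc n)) ∎
    where lem : ∀ a b F G x y → a * F + b * G + (a * x + b * y) ≡ a * (F + x) + b * (G + y)
          lem = solve-∀

  sumTo-shift : ∀ n (f : ℕ → ℕ) → sumTo (suc n) f ≡ f 0 + sumTo n (λ i → f (suc i))
  sumTo-shift zero    f = refl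
  sumTo-shift (suc n) f = trans (cong (_+ f (suc (suc n))) (sumTo-shift n f)) (+-assoc (f 0) _ _)

  sumTo-extend : ∀ k n (f : ℕ → ℕ) → (∀ i → n < i → f i ≡ 0) → sumTo (k + n) f ≡ sumTo n f
  sumTo-extend zero    n f f≡0 = refl
  sumTo-extend (suc k) n f f≡0 = begin
    sumTo (k + n) f + f (suc (k + n))   ≡⟨ cong (sumTo (k + n) f +_) (f≡0 (suc (k + n)) (s≤s (m≤n+m n k))) ⟩
    sumTo (k + n) f + 0                 ≡⟨ +-identityʳ _ ⟩
    sumTo (k + n) f                     ≡⟨ sumTo-extend k n f f≡0 ⟩
    sumTo n f                           ∎

  sumTo-first≤ : ∀ n (f : ℕ → ℕ) → f 0 ≤ sumTo n f
  sumTo-first≤ zero    f = ≤-refl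
  sumTo-first≤ (suc n) f = ≤-trans (sumTo-first≤ n f) (m≤m+n _ _)

  sumBelow-suc : ∀ n (f : ℕ → ℕ) → sumBelow (suc n) f ≡ sumTo n f
  sumBelow-suc zero    f = refl
  sumBelow-suc (suc n) f = cong (_+ f (suc n)) (sumBelow-suc n f)

  term : ℕ → ℕ → ℕ → ℕ
  term α M k = (M C k) * 3 ^ k * α ^ M * (α + 1) ^ (M ∸ k)

  term-vanishes : ∀ α {M k} → M < k → term α M k ≡ 0
  term-vanishes α {M} {k} M<k = cong (λ c → c * 3 ^ k * α ^ M * (α + 1) ^ (M ∸ k)) (k>n⇒nCk≡0 M<k)

  C-pow-∸-suc : ∀ M k x → (M C suc k) * x ^ (M ∸ k) ≡ (M C suc k) * (x * x ^ (M ∸ suc k))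
  C-pow-∸-suc M k x with k <? M
  ... | yes k<M = cong (λ e → (M C suc k) * x ^ e) (+-∸-assoc 1 k<M)
  ... | no  k≮M rewrite k>n⇒nCk≡0 {M} {suc k} (s≤s (≮⇒≥ k≮M)) = refl

  term-pascal : ∀ α M k → term α (suc M) (suc k) ≡ α * (α + 1) * term α M (suc k) + 3 * α * term α M k
  term-pascal α M k = begin
    (suc M C suc k) * (3 * P) * (α * A) * Q ^ (M ∸ k)
      ≡⟨ cong (λ c → c * (3 * P) * (α * A) * Q ^ (M ∸ k)) (nCk+nC[k+1]≡[n+1]C[k+1] M k) ⟨
    (M C k + M C suc k) * (3 * P) * (α * A) * Q ^ (M ∸ k)
      ≡⟨ lem₁ (M C k) (M C suc k) P A (Q ^ (M ∸ k)) α ⟩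
    3 * α * ((M C k) * P * A * Q ^ (M ∸ k)) + 3 * α * P * A * ((M C suc k) * Q ^ (M ∸ k))
      ≡⟨ cong (λ z → 3 * α * ((M C k) * P * A * Q ^ (M ∸ k)) + 3 * α * P * A * z) (C-pow-∸-suc M k Q) ⟩
    3 * α * ((M C k) * P * A * Q ^ (M ∸ k)) + 3 * α * P * A * ((M C suc k) * (Q * Q ^ (M ∸ suc k)))
      ≡⟨ lem₂ (M C k) (M C suc k) P A (Q ^ (M ∸ k)) (Q ^ (M ∸ suc k)) α ⟩
    α * Q * ((M C suc k) * (3 * P) * A * Q ^ (M ∸ suc k)) + 3 * α * ((M C k) * P * A * Q ^ (M ∸ k)) ∎
    where
    P = 3 ^ k
    A = α ^ M
    Q = α + 1
    lem₁ : ∀ c c′ P A E α → (c + c′) * (3 * P) * (α * A) * E ≡ 3 * α * (c * P * A * E) + 3 * α * P * A * (c′ * E)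
    lem₁ = solve-∀
    lem₂ : ∀ c c′ P A E E′ α → 3 * α * (c * P * A * E) + 3 * α * P * A * (c′ * ((α + 1) * E′))
                               ≡ α * (α + 1) * (c′ * (3 * P) * A * E′) + 3 * α * (c * P * A * E)
    lem₂ = solve-∀

  term-suc-0 : ∀ α M → term α (suc M) 0 ≡ α * (α + 1) * term α M 0
  term-suc-0 α M = lem (α ^ M) ((α + 1) ^ M) α
    where lem : ∀ A E α → 1 * 1 * (α * A) * ((α + 1) * E) ≡ α * (α + 1) * (1 * 1 * A * E)
          lem = solve-∀

  -- Σ_{i ≤ N} C(N + i, 3i + j) 3^{3i+j} α^{N+i} (α + 1)^{N−2i−j}; the index is written j + i * 3 so
  -- that the successor cases below match term-pascal definitionally.
  binomSum : ℕ → ℕ → ℕ → ℕ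
  binomSum α j N = sumTo N (λ i → term α (N + i) (j + i * 3))

  term-beyond : ∀ α {N} i j → N < i + i + j → term α (N + i) (j + i * 3) ≡ 0
  term-beyond α {N} i j N<2i+j = term-vanishes α (subst (N + i <_) (lem i j) (+-monoˡ-< i N<2i+j))
    where lem : ∀ i j → i + i + j + i ≡ j + i * 3
          lem = solve-∀

  binomSum-tail : ∀ α j N i → N < i → term α (N + i) (j + i * 3) ≡ 0
  binomSum-tail α j N i N<i = term-beyond α i j (≤-trans N<i (≤-trans (m≤m+n i i) (m≤m+n (i + i) j)))

  binomSum-suc : ∀ α j N → binomSum α (suc j) (suc N) ≡ α * (α + 1) * binomSum α (suc j) N + 3 * α * binomSum α j N
  binomSum-suc α j N = begin
    sumTo (suc N) (λ i → term α (suc N + i) (suc j + i * 3))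
      ≡⟨ sumTo-cong (suc N) (λ i _ → term-pascal α (N + i) (j + i * 3)) ⟩
    sumTo (suc N) (λ i → c * term α (N + i) (suc j + i * 3) + 3 * α * term α (N + i) (j + i * 3))
      ≡⟨ sumTo-linear (suc N) c (3 * α) _ _ ⟩
    c * sumTo (suc N) (λ i → term α (N + i) (suc j + i * 3)) + 3 * α * sumTo (suc N) (λ i → term α (N + i) (j + i * 3))
      ≡⟨ cong₂ (λ x y → c * x + 3 * α * y) (sumTo-extend 1 N _ (binomSum-tail α (suc j) N))
                                          (sumTo-extend 1 N _ (binomSum-tail α j N)) ⟩
    c * binomSum α (suc j) N + 3 * α * binomSum α j N ∎
    where c = α * (α + 1)

  binomSum-zero : ∀ α N → binomSum α 0 (suc N) ≡ α * (α + 1) * binomSum α 0 N + 3 * α * binomSum α 2 (suc N)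
  binomSum-zero α N = begin
    sumTo (suc N) (λ i → term α (suc N + i) (i * 3))
      ≡⟨ sumTo-shift N _ ⟩
    term α (suc N + 0) 0 + sumTo N (λ i → term α (suc N + suc i) (3 + i * 3))
      ≡⟨ cong₂ _+_ (term-suc-0 α (N + 0)) (sumTo-cong N λ i _ →
           trans (term-pascal α (N + suc i) (2 + i * 3))
                 (cong (λ M → c * term α (N + suc i) (3 + i * 3) + 3 * α * term α M (2 + i * 3)) (+-suc N i))) ⟩
    c * term α (N + 0) 0 + sumTo N (λ i → c * term α (N + suc i) (3 + i * 3) + 3 * α * term α (suc N + i) (2 + i * 3))
      ≡⟨ cong (c * term α (N + 0) 0 +_) (sumTo-linear N c (3 * α) _ _) ⟩
    c * term α (N + 0) 0 + (c * sumTo N (λ i → term α (N + suc i) (3 + i * 3)) + 3 * α * sumTo N (λ i → term α (suc N + i) (2 + i * 3)))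
      ≡⟨ lem c (term α (N + 0) 0) _ _ ⟩
    c * (term α (N + 0) 0 + sumTo N (λ i → term α (N + suc i) (3 + i * 3))) + 3 * α * sumTo N (λ i → term α (suc N + i) (2 + i * 3))
      ≡⟨ cong₂ (λ x y → c * x + 3 * α * y) (sumTo-shift N (λ i → term α (N + i) (i * 3)))
                                          (sumTo-extend 1 N _ tail₂) ⟨
    c * sumTo (suc N) (λ i → term α (N + i) (i * 3)) + 3 * α * binomSum α 2 (suc N)
      ≡⟨ cong (λ x → c * x + 3 * α * binomSum α 2 (suc N)) (sumTo-extend 1 N _ (binomSum-tail α 0 N)) ⟩
    c * binomSum α 0 N + 3 * α * binomSum α 2 (suc N) ∎
    where
    c = α * (α + 1)
    lem : ∀ c t s r → c * t + (c * s + r) ≡ c * (t + s) + r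
    lem = solve-∀
    tail₂ : ∀ i → N < i → term α (suc N + i) (2 + i * 3) ≡ 0
    tail₂ i N<i = term-beyond α {suc N} i 2 (≤-trans (s≤s N<i) (≤-trans (m≤n+m (suc i) (i + 1)) (≤-reflexive (lem₂ i))))
      where lem₂ : ∀ i → i + 1 + suc i ≡ i + i + 2
            lem₂ = solve-∀

  -- Coordinatewise, P (u + vθ + wθ²) = a₀ + a₁ (θ + θ²) + a₂ (αθ + θ² − α), with θ³ = α.
  Represents : ℕ → ℕ → Triple → ℕ × ℕ × ℕ → Set
  Represents α P ⟨ u , v , w ⟩ (a₀ , a₁ , a₂) = P * u + α * a₂ ≡ a₀ × P * v ≡ a₁ + α * a₂ × P * w ≡ a₁ + a₂

  represents-mul1+θ³ : ∀ α {P a₀ a₁ a₂} t → Represents α P t (a₀ , a₁ , a₂) →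
    let a₁′ = α * (α + 1) * a₁ + 3 * α * a₀
        a₂′ = α * (α + 1) * a₂ + 3 * α * a₁
    in Represents α (α * P) (mul1+θ α (mul1+θ α (mul1+θ α t))) (α * (α + 1) * a₀ + 3 * α * a₂′ , a₁′ , a₂′)
  represents-mul1+θ³ α {P} {a₀} {a₁} {a₂} ⟨ u , v , w ⟩ (h₀ , h₁ , h₂) = r₀ , r₁ , r₂
    where
    c = α * (α + 1)
    a₁′ = c * a₁ + 3 * α * a₀
    a₂′ = c * a₂ + 3 * α * a₁
    r₀ : α * P * (u + α * w + α * (v + w) + α * (u + v + (v + w))) + α * a₂′ ≡ c * a₀ + 3 * α * a₂′
    r₀ = begin
      α * P * (u + α * w + α * (v + w) + α * (u + v + (v + w))) + α * a₂′
        ≡⟨ lem₁ α P u v w a₁ a₂ ⟩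
      c * (P * u) + 3 * α * α * (P * v) + 3 * α * α * (P * w) + α * a₂′
        ≡⟨ cong₂ (λ x y → c * (P * u) + 3 * α * α * x + 3 * α * α * y + α * a₂′) h₁ h₂ ⟩
      c * (P * u) + 3 * α * α * (a₁ + α * a₂) + 3 * α * α * (a₁ + a₂) + α * a₂′
        ≡⟨ lem₂ α (P * u) a₁ a₂ ⟩
      c * (P * u + α * a₂) + 3 * α * a₂′
        ≡⟨ cong (λ x → c * x + 3 * α * a₂′) h₀ ⟩
      c * a₀ + 3 * α * a₂′ ∎
      where
      lem₁ : ∀ α P u v w a₁ a₂ →
        α * P * (u + α * w + α * (v + w) + α * (u + v + (v + w))) + α * (α * (α + 1) * a₂ + 3 * α * a₁)
          ≡ α * (α + 1) * (P * u) + 3 * α * α * (P * v) + 3 * α * α * (P * w) + α * (α * (α + 1) * a₂ + 3 * α * a₁)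
      lem₁ = solve-∀
      lem₂ : ∀ α X a₁ a₂ →
        α * (α + 1) * X + 3 * α * α * (a₁ + α * a₂) + 3 * α * α * (a₁ + a₂) + α * (α * (α + 1) * a₂ + 3 * α * a₁)
          ≡ α * (α + 1) * (X + α * a₂) + 3 * α * (α * (α + 1) * a₂ + 3 * α * a₁)
      lem₂ = solve-∀
    r₁ : α * P * (u + α * w + α * (v + w) + (u + α * w + (u + v))) ≡ a₁′ + α * a₂′
    r₁ = begin
      α * P * (u + α * w + α * (v + w) + (u + α * w + (u + v)))
        ≡⟨ lem₁ α P u v w ⟩
      3 * α * (P * u) + c * (P * v) + 3 * α * α * (P * w)
        ≡⟨ cong₂ (λ x y → 3 * α * (P * u) + c * x + 3 * α * α * y) h₁ h₂ ⟩
      3 * α * (P * u) + c * (a₁ + α * a₂) + 3 * α * α * (a₁ + a₂)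
        ≡⟨ lem₂ α (P * u) a₁ a₂ ⟩
      c * a₁ + 3 * α * (P * u + α * a₂) + α * a₂′
        ≡⟨ cong (λ x → c * a₁ + 3 * α * x + α * a₂′) h₀ ⟩
      a₁′ + α * a₂′ ∎
      where
      lem₁ : ∀ α P u v w → α * P * (u + α * w + α * (v + w) + (u + α * w + (u + v)))
                           ≡ 3 * α * (P * u) + α * (α + 1) * (P * v) + 3 * α * α * (P * w)
      lem₁ = solve-∀
      lem₂ : ∀ α X a₁ a₂ → 3 * α * X + α * (α + 1) * (a₁ + α * a₂) + 3 * α * α * (a₁ + a₂)
                           ≡ α * (α + 1) * a₁ + 3 * α * (X + α * a₂) + α * (α * (α + 1) * a₂ + 3 * α * a₁)
      lem₂ = solve-∀
    r₂ : α * P * (u + α * w + (u + v) + (u + v + (v + w))) ≡ a₁′ + a₂′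
    r₂ = begin
      α * P * (u + α * w + (u + v) + (u + v + (v + w)))
        ≡⟨ lem₁ α P u v w ⟩
      3 * α * (P * u) + 3 * α * (P * v) + c * (P * w)
        ≡⟨ cong₂ (λ x y → 3 * α * (P * u) + 3 * α * x + c * y) h₁ h₂ ⟩
      3 * α * (P * u) + 3 * α * (a₁ + α * a₂) + c * (a₁ + a₂)
        ≡⟨ lem₂ α (P * u) a₁ a₂ ⟩
      c * a₁ + 3 * α * (P * u + α * a₂) + a₂′
        ≡⟨ cong (λ x → c * a₁ + 3 * α * x + a₂′) h₀ ⟩
      a₁′ + a₂′ ∎
      where
      lem₁ : ∀ α P u v w → α * P * (u + α * w + (u + v) + (u + v + (v + w)))
                           ≡ 3 * α * (P * u) + 3 * α * (P * v) + α * (α + 1) * (P * w)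
      lem₁ = solve-∀
      lem₂ : ∀ α X a₁ a₂ → 3 * α * X + 3 * α * (a₁ + α * a₂) + α * (α + 1) * (a₁ + a₂)
                           ≡ α * (α + 1) * a₁ + 3 * α * (X + α * a₂) + (α * (α + 1) * a₂ + 3 * α * a₁)
      lem₂ = solve-∀

  pow1+θ-binomSum : ∀ α N → Represents α (α ^ N) (pow1+θ α (N * 3)) (binomSum α 0 N , binomSum α 1 N , binomSum α 2 N)
  pow1+θ-binomSum α zero rewrite *-zeroʳ α = refl , refl , refl
  pow1+θ-binomSum α (suc N) =
    subst (Represents α (α ^ suc N) (pow1+θ α (suc N * 3)))
      (sym (cong₂ _,_ (trans (binomSum-zero α N) (cong (λ x → c * binomSum α 0 N + 3 * α * x) (binomSum-suc α 1 N)))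
                      (cong₂ _,_ (binomSum-suc α 0 N) (binomSum-suc α 1 N))))
      (represents-mul1+θ³ α (pow1+θ α (N * 3)) (pow1+θ-binomSum α N))
    where c = α * (α + 1)

  represents-mul1+θ : ∀ α {P a₀ a₁ a₂} t → Represents α P t (a₀ , a₁ , a₂) →
    P * Triple.u (mul1+θ α t) ≡ a₀ + α * a₁ × P * Triple.v (mul1+θ α t) ≡ a₀ + a₁
  represents-mul1+θ α {P} {a₀} {a₁} {a₂} ⟨ u , v , w ⟩ (h₀ , h₁ , h₂) = eq-u , eq-v
    where
    eq-u : P * (u + α * w) ≡ a₀ + α * a₁
    eq-u = begin
      P * (u + α * w)           ≡⟨ lem₁ P u α w ⟩
      P * u + α * (P * w)       ≡⟨ cong (λ x → P * u + α * x) h₂ ⟩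
      P * u + α * (a₁ + a₂)     ≡⟨ lem₂ (P * u) α a₁ a₂ ⟩
      P * u + α * a₂ + α * a₁   ≡⟨ cong (_+ α * a₁) h₀ ⟩
      a₀ + α * a₁               ∎
      where
      lem₁ : ∀ P u α w → P * (u + α * w) ≡ P * u + α * (P * w)
      lem₁ = solve-∀
      lem₂ : ∀ X α a₁ a₂ → X + α * (a₁ + a₂) ≡ X + α * a₂ + α * a₁
      lem₂ = solve-∀
    eq-v : P * (u + v) ≡ a₀ + a₁
    eq-v = begin
      P * (u + v)               ≡⟨ *-distribˡ-+ P u v ⟩
      P * u + P * v             ≡⟨ cong (P * u +_) h₁ ⟩
      P * u + (a₁ + α * a₂)     ≡⟨ lem (P * u) a₁ (α * a₂) ⟩
      P * u + α * a₂ + a₁       ≡⟨ cong (_+ a₁) h₀ ⟩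
      a₀ + a₁                   ∎
      where lem : ∀ X a y → X + (a + y) ≡ X + y + a
            lem = solve-∀

  ∸-2*-term : ∀ N i j → (N + i) ∸ (j + i * 3) ≡ N ∸ 2 * i ∸ j
  ∸-2*-term N i j = begin
    (N + i) ∸ (j + i * 3)         ≡⟨ cong₂ _∸_ (+-comm N i) (lem i j) ⟩
    (i + N) ∸ (i + (2 * i + j))   ≡⟨ [m+n]∸[m+o]≡n∸o i N (2 * i + j) ⟩
    N ∸ (2 * i + j)               ≡⟨ ∸-+-assoc N (2 * i) j ⟨
    N ∸ 2 * i ∸ j                 ∎
    where lem : ∀ i j → j + i * 3 ≡ i + (2 * i + j)
          lem = solve-∀

  summand≡term : ∀ α N i j → 2 * i + j ≤ N →
    ((N + i) C (N ∸ 2 * i ∸ j)) * 3 ^ (3 * i + j) * α ^ (N + i) * (α + 1) ^ (N ∸ 2 * i ∸ j) ≡ term α (N + i) (j + i * 3)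
  summand≡term α N i j 2i+j≤N = begin
    ((N + i) C (N ∸ 2 * i ∸ j)) * 3 ^ (3 * i + j) * α ^ (N + i) * (α + 1) ^ (N ∸ 2 * i ∸ j)
      ≡⟨ cong₂ (λ e p → ((N + i) C e) * 3 ^ p * α ^ (N + i) * (α + 1) ^ e) (∸-2*-term N i j) (lem i j) ⟨
    ((N + i) C ((N + i) ∸ k)) * 3 ^ k * α ^ (N + i) * (α + 1) ^ ((N + i) ∸ k)
      ≡⟨ cong (λ c → c * 3 ^ k * α ^ (N + i) * (α + 1) ^ ((N + i) ∸ k)) (nCk≡nC[n∸k] k≤N+i) ⟨
    term α (N + i) k ∎
    where
    k = j + i * 3
    lem : ∀ i j → j + i * 3 ≡ 3 * i + j
    lem = solve-∀
    k≤N+i : k ≤ N + i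
    k≤N+i = subst (_≤ N + i) (lem′ i j) (+-monoˡ-≤ i 2i+j≤N)
      where lem′ : ∀ i j → 2 * i + j + i ≡ j + i * 3
            lem′ = solve-∀

  aSeq-binomSum : ∀ α n → aSeq α n ≡ binomSum α 0 (2 * n)
  aSeq-binomSum α n = begin
    aSeq α n                        ≡⟨ sumTo-cong n (λ i i≤n →
                                         trans (cong (λ p → ((2 * n + i) C (2 * n ∸ 2 * i)) * 3 ^ p * α ^ (2 * n + i) * (α + 1) ^ (2 * n ∸ 2 * i))
                                                     (sym (+-identityʳ (3 * i))))
                                               (summand≡term α (2 * n) i 0 (subst (_≤ 2 * n) (sym (+-identityʳ (2 * i))) (*-monoʳ-≤ 2 i≤n)))) ⟩
    sumTo n g                       ≡⟨ sumTo-extend n n g g-tail ⟨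
    sumTo (n + n) g                 ≡⟨ cong (λ m → sumTo m g) (lem n) ⟩
    binomSum α 0 (2 * n)            ∎
    where
    g = λ i → term α (2 * n + i) (i * 3)
    g-tail : ∀ i → n < i → g i ≡ 0
    g-tail i n<i = term-beyond α i 0 (<-≤-trans (*-monoʳ-< 2 n<i) (≤-reflexive (lem′ i)))
      where lem′ : ∀ i → 2 * i ≡ i + i + 0
            lem′ = solve-∀
    lem : ∀ n → n + n ≡ 2 * n
    lem = solve-∀

  bSeq-binomSum : ∀ α m → bSeq α (suc m) ≡ binomSum α 1 (2 * suc m)
  bSeq-binomSum α m = begin
    bSeq α n                        ≡⟨ sumBelow-suc m _ ⟩
    sumTo m _                       ≡⟨ sumTo-cong m (λ i i≤m → summand≡term α (2 * n) i 1 (2i+1≤2n i≤m)) ⟩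
    sumTo m g                       ≡⟨ sumTo-extend (suc (suc m)) m g g-tail ⟨
    sumTo (suc (suc m) + m) g       ≡⟨ cong (λ k → sumTo k g) (lem m) ⟩
    binomSum α 1 (2 * n)            ∎
    where
    n = suc m
    g = λ i → term α (2 * n + i) (1 + i * 3)
    2i+1≤2n : ∀ {i} → i ≤ m → 2 * i + 1 ≤ 2 * n
    2i+1≤2n {i} i≤m = ≤-trans (+-monoˡ-≤ 1 (*-monoʳ-≤ 2 i≤m)) (≤-trans (m≤m+n (2 * m + 1) 1) (≤-reflexive (lem′ m)))
      where lem′ : ∀ m → 2 * m + 1 + 1 ≡ 2 * suc m
            lem′ = solve-∀
    g-tail : ∀ i → m < i → g i ≡ 0
    g-tail i m<i = term-beyond α i 1 (≤-<-trans (*-monoʳ-≤ 2 m<i) (subst (2 * i <_) (lem′ i) (n<1+n (2 * i))))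
      where lem′ : ∀ i → suc (2 * i) ≡ i + i + 1
            lem′ = solve-∀
    lem : ∀ m → suc (suc m) + m ≡ 2 * suc m
    lem = solve-∀

module Approximants where

  open import Data.Nat using (ℕ; suc; _+_; _*_; _^_; _∸_; _≤_; _<_; z≤n; s≤s; NonZero; >-nonZero)
  open import Data.Nat.Properties
  open import Data.Nat.Combinatorics using (_C_; nC1≡n)
  open import Data.Nat.Tactic.RingSolver using (solve-∀)
  open import Data.Integer as ℤ using (+_; ∣_∣)
  import Data.Integer.Properties as ℤ
  import Data.Integer.Tactic.RingSolver as ℤ
  open import Data.Product using (_×_; _,_; proj₁; proj₂)
  open import Relation.Binary.PropositionalEquality
  open PowersOf1+θ
  open BinomialSums

  open ≤-Reasoning

  bSeq-pos : ∀ {α} → 1 ≤ α → ∀ m → 0 < bSeq α (suc m)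
  bSeq-pos {α} 1≤α m = begin-strict
    0                                 <⟨ *-mono-< (*-mono-< (*-mono-< C-pos (s≤s z≤n)) (m^n>0 α (N + 0))) (m^n>0 (α + 1) (N + 0 ∸ 1)) ⟩
    term α (N + 0) 1                  ≤⟨ sumTo-first≤ N _ ⟩
    binomSum α 1 N                    ≡⟨ bSeq-binomSum α m ⟨
    bSeq α (suc m)                    ∎
    where
    N = 2 * suc m
    instance
      α≢0 : NonZero α
      α≢0 = >-nonZero 1≤α
      α+1≢0 : NonZero (α + 1)
      α+1≢0 = >-nonZero (m≤n+m 1 α)
    C-pos : 0 < (N + 0) C 1
    C-pos = subst (0 <_) (sym (nC1≡n (N + 0))) (s≤s z≤n)

  approximant-cubeDefect : ∀ {α} → 1 ≤ α → ∀ c m → c * cubeDefectBound α ≤ m →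
    let a = aSeq α (suc m)
        b = bSeq α (suc m)
    in c * cubeDefect α (a + α * b) (a + b) < (a + b) * (a + b) * (a + b)
  approximant-cubeDefect {α} 1≤α c m cB≤m = begin-strict
    c * cubeDefect α (a + α * b) (a + b)   ≡⟨ cong₂ (λ x y → c * cubeDefect α x y) U≡ V≡ ⟩
    c * cubeDefect α (s * u) (s * v)       ≡⟨ cong (c *_) (cubeDefect-* α s u v) ⟩
    c * (s * s * s * cubeDefect α u v)     ≡⟨ lem₁ c (s * s * s) (cubeDefect α u v) ⟩
    s * s * s * (c * cubeDefect α u v)     <⟨ *-monoʳ-< (s * s * s) small ⟩
    s * s * s * (v * v * v)                ≡⟨ lem₂ s v ⟩
    s * v * (s * v) * (s * v)              ≡⟨ cong (λ x → x * x * x) V≡ ⟨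
    (a + b) * (a + b) * (a + b)            ∎
    where
    a = aSeq α (suc m)
    b = bSeq α (suc m)
    N = 2 * suc m
    s = α ^ N
    t = pow1+θ α (suc (N * 3))
    u = Triple.u t
    v = Triple.v t
    represented = represents-mul1+θ α {s} (pow1+θ α (N * 3)) (pow1+θ-binomSum α N)
    U≡ : a + α * b ≡ s * u
    U≡ = trans (cong₂ (λ x y → x + α * y) (aSeq-binomSum α (suc m)) (bSeq-binomSum α m)) (sym (proj₁ represented))
    V≡ : a + b ≡ s * v
    V≡ = trans (cong₂ _+_ (aSeq-binomSum α (suc m)) (bSeq-binomSum α m)) (sym (proj₂ represented))
    exponent : 2 + (5 + 6 * m) ≡ suc (N * 3)
    exponent = lem m
      where lem : ∀ m → 2 + (5 + 6 * m) ≡ suc (2 * suc m * 3)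
            lem = solve-∀
    small : c * cubeDefect α u v < v * v * v
    small = subst (λ t → c * cubeDefect α (Triple.u t) (Triple.v t) < Triple.v t * Triple.v t * Triple.v t)
                  (cong (pow1+θ α) exponent)
                  (pow1+θ-cubeDefect-small 1≤α c (5 + 6 * m) (≤-trans cB≤m (≤-trans (m≤n*m m 6) (m≤n+m (6 * m) 5))))
    instance
      s³≢0 : NonZero (s * s * s)
      s³≢0 = >-nonZero (*-mono-< (*-mono-< (m^n>0 α N) (m^n>0 α N)) (m^n>0 α N))
        where instance α≢0 : NonZero α
                       α≢0 = >-nonZero 1≤α
    lem₁ : ∀ c S E → c * (S * E) ≡ S * (c * E)
    lem₁ = solve-∀
    lem₂ : ∀ s v → s * s * s * (v * v * v) ≡ s * v * (s * v) * (s * v)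
    lem₂ = solve-∀

  ∣m-n∣-bound : ∀ c m n z → c * ∣ + m ℤ.- + n ∣ < z → c * m < z + c * n × c * n < z + c * m
  ∣m-n∣-bound c m n z c∣m-n∣<z =
    bound m n (≤-trans (≤-reflexive (cong ∣_∣ (sym (cancel (+ m) (+ n))))) (ℤ.∣i+j∣≤∣i∣+∣j∣ (+ m ℤ.- + n) (+ n))) ,
    bound n m (≤-trans (≤-reflexive (cong ∣_∣ (sym (cancel (+ n) (+ m))))) (subst (λ d → ∣ + n ℤ.- + m ℤ.+ + m ∣ ≤ d + m)
      (ℤ.∣i-j∣≡∣j-i∣ (+ n) (+ m)) (ℤ.∣i+j∣≤∣i∣+∣j∣ (+ n ℤ.- + m) (+ m))))
    where
    d = ∣ + m ℤ.- + n ∣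
    cancel : ∀ x y → x ℤ.- y ℤ.+ y ≡ x
    cancel = ℤ.solve-∀
    bound : ∀ p q → p ≤ d + q → c * p < z + c * q
    bound p q p≤d+q = begin-strict
      c * p             ≤⟨ *-monoʳ-≤ c p≤d+q ⟩
      c * (d + q)       ≡⟨ *-distribˡ-+ c d q ⟩
      c * d + c * q     <⟨ +-monoˡ-< (c * q) c∣m-n∣<z ⟩
      z + c * q         ∎

module RationalBounds where

  open import Data.Nat as ℕ using (ℕ; suc; z≤n; s≤s)
  open import Data.Integer as ℤ using (+_; +0; +[1+_]; -[1+_])
  import Data.Integer.Properties as ℤ
  import Data.Integer.Tactic.RingSolver as ℤ
  open import Data.Rational
    using (ℚ; mkℚ; 0ℚ; 1ℚ; _+_; _*_; _-_; _<_; _≤_; 1/_; toℚᵘ; NonZero; ≢-nonZero; nonNegative; nonPositive; *<*)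
  open import Data.Rational.Properties
  import Data.Rational.Unnormalised as ℚᵘ
  import Data.Rational.Unnormalised.Properties as ℚᵘ
  open import Data.Rational.Solver using (module +-*-Solver)
  open +-*-Solver using (solve; _:=_; con; _:+_; _:*_; _:-_)
  open import Data.Product using (∃-syntax; _×_; _,_)
  open import Data.Sum using (inj₁; inj₂)
  open import Data.Empty using (⊥-elim)
  open import Relation.Binary.PropositionalEquality
  open import Relation.Nullary using (yes; no)

  toℚᵘ-toℚ : ∀ m → toℚᵘ (toℚ m) ℚᵘ.≃ ℚᵘ.mkℚᵘ (+ m) 0
  toℚᵘ-toℚ m = toℚᵘ-fromℚᵘ (ℚᵘ.mkℚᵘ (+ m) 0)

  toℚ-+ : ∀ m n → toℚ (m ℕ.+ n) ≡ toℚ m + toℚ n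
  toℚ-+ m n = toℚᵘ-injective (ℚᵘ.≃-trans (toℚᵘ-toℚ (m ℕ.+ n)) (ℚᵘ.≃-trans +-embedded (ℚᵘ.≃-sym
    (ℚᵘ.≃-trans (toℚᵘ-homo-+ (toℚ m) (toℚ n)) (ℚᵘ.+-cong (toℚᵘ-toℚ m) (toℚᵘ-toℚ n))))))
    where
    +-embedded : ℚᵘ.mkℚᵘ (+ (m ℕ.+ n)) 0 ℚᵘ.≃ ℚᵘ.mkℚᵘ (+ m) 0 ℚᵘ.+ ℚᵘ.mkℚᵘ (+ n) 0
    +-embedded = ℚᵘ.*≡* (trans (cong (ℤ._* + 1) (ℤ.pos-+ m n)) (lem (+ m) (+ n)))
      where lem : ∀ x y → (x ℤ.+ y) ℤ.* + 1 ≡ (x ℤ.* + 1 ℤ.+ y ℤ.* + 1) ℤ.* + 1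
            lem = ℤ.solve-∀

  toℚ-* : ∀ m n → toℚ (m ℕ.* n) ≡ toℚ m * toℚ n
  toℚ-* m n = toℚᵘ-injective (ℚᵘ.≃-trans (toℚᵘ-toℚ (m ℕ.* n)) (ℚᵘ.≃-trans *-embedded (ℚᵘ.≃-sym
    (ℚᵘ.≃-trans (toℚᵘ-homo-* (toℚ m) (toℚ n)) (ℚᵘ.*-cong (toℚᵘ-toℚ m) (toℚᵘ-toℚ n))))))
    where
    *-embedded : ℚᵘ.mkℚᵘ (+ (m ℕ.* n)) 0 ℚᵘ.≃ ℚᵘ.mkℚᵘ (+ m) 0 ℚᵘ.* ℚᵘ.mkℚᵘ (+ n) 0
    *-embedded = ℚᵘ.*≡* (cong (ℤ._* + 1) (ℤ.pos-* m n))

  toℚ-cube : ∀ n → toℚ (n ℕ.* n ℕ.* n) ≡ toℚ n * toℚ n * toℚ n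
  toℚ-cube n = trans (toℚ-* (n ℕ.* n) n) (cong (_* toℚ n) (toℚ-* n n))

  toℚ-mono-< : ∀ {m n} → m ℕ.< n → toℚ m < toℚ n
  toℚ-mono-< {m} {n} m<n = toℚᵘ-cancel-<
    (ℚᵘ.≤-<-trans (ℚᵘ.≤-reflexive (toℚᵘ-toℚ m)) (ℚᵘ.<-≤-trans embedded (ℚᵘ.≤-reflexive (ℚᵘ.≃-sym (toℚᵘ-toℚ n)))))
    where
    embedded : ℚᵘ.mkℚᵘ (+ m) 0 ℚᵘ.< ℚᵘ.mkℚᵘ (+ n) 0
    embedded = ℚᵘ.*<* (subst₂ ℤ._<_ (sym (ℤ.*-identityʳ (+ m))) (sym (ℤ.*-identityʳ (+ n))) (ℤ.+<+ m<n))

  toℚ-mono-≤ : ∀ {m n} → m ℕ.≤ n → toℚ m ≤ toℚ n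
  toℚ-mono-≤ {m} {n} m≤n = toℚᵘ-cancel-≤
    (ℚᵘ.≤-trans (ℚᵘ.≤-reflexive (toℚᵘ-toℚ m)) (ℚᵘ.≤-trans embedded (ℚᵘ.≤-reflexive (ℚᵘ.≃-sym (toℚᵘ-toℚ n)))))
    where
    embedded : ℚᵘ.mkℚᵘ (+ m) 0 ℚᵘ.≤ ℚᵘ.mkℚᵘ (+ n) 0
    embedded = ℚᵘ.*≤* (subst₂ ℤ._≤_ (sym (ℤ.*-identityʳ (+ m))) (sym (ℤ.*-identityʳ (+ n))) (ℤ.+≤+ m≤n))

  archimedean : ∀ ε → 0ℚ < ε → ∃[ q ] 1ℚ ≤ ε * toℚ q
  archimedean (mkℚ +0       _ _) (*<* (ℤ.+<+ ()))
  archimedean (mkℚ -[1+ _ ] _ _) (*<* ())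
  archimedean ε@(mkℚ +[1+ p ] d _) _ = suc d , subst (1ℚ ≤_) (sym ε*[1+d]≡1+p) (toℚ-mono-≤ {1} {suc p} (s≤s z≤n))
    where
    ε*[1+d]≡1+p : ε * toℚ (suc d) ≡ toℚ (suc p)
    ε*[1+d]≡1+p = toℚᵘ-injective (ℚᵘ.≃-trans (toℚᵘ-homo-* ε (toℚ (suc d)))
      (ℚᵘ.≃-trans (ℚᵘ.*-congˡ {toℚᵘ ε} (toℚᵘ-toℚ (suc d))) (ℚᵘ.≃-trans denominator-cancels (ℚᵘ.≃-sym (toℚᵘ-toℚ (suc p))))))
      where
      denominator-cancels : ℚᵘ.mkℚᵘ (+ suc p) d ℚᵘ.* ℚᵘ.mkℚᵘ (+ suc d) 0 ℚᵘ.≃ ℚᵘ.mkℚᵘ (+ suc p) 0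
      denominator-cancels = ℚᵘ.*≡* (trans (lem (+ suc p) (+ suc d)) (cong (+ suc p ℤ.*_) (sym (ℤ.pos-* (suc d) 1))))
        where lem : ∀ P D → P ℤ.* D ℤ.* + 1 ≡ P ℤ.* (D ℤ.* + 1)
              lem = ℤ.solve-∀

  ÷′-*-cancel : ∀ p q → q ≢ 0ℚ → (p ÷' q) * q ≡ p
  ÷′-*-cancel p q q≢0 with q ≟ 0ℚ
  ... | yes q≡0 = ⊥-elim (q≢0 q≡0)
  ... | no  q≢0′ = trans (*-assoc p (1/ q) q) (trans (cong (p *_) (*-inverseˡ q)) (*-identityʳ p))
    where instance
      q-nonZero : NonZero q
      q-nonZero = ≢-nonZero q≢0′

  1+[c-1]÷′[A÷′B+1]*[A+B]≡A+c*B : ∀ A B c → B ≢ 0ℚ → A + B ≢ 0ℚ →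
    (1ℚ + ((c - 1ℚ) ÷' ((A ÷' B) + 1ℚ))) * (A + B) ≡ A + c * B
  1+[c-1]÷′[A÷′B+1]*[A+B]≡A+c*B A B c B≢0 A+B≢0 = begin
    (1ℚ + y) * (A + B)         ≡⟨ cong ((1ℚ + y) *_) D*B≡A+B ⟨
    (1ℚ + y) * (D * B)         ≡⟨ lem₁ y D B ⟩
    D * B + (y * D) * B        ≡⟨ cong₂ (λ p q → p + q * B) D*B≡A+B (÷′-*-cancel (c - 1ℚ) D D≢0) ⟩
    (A + B) + (c - 1ℚ) * B     ≡⟨ lem₂ A B c ⟩
    A + c * B                  ∎
    where
    open ≡-Reasoning
    D = (A ÷' B) + 1ℚ
    y = (c - 1ℚ) ÷' D
    D*B≡A+B : D * B ≡ A + B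
    D*B≡A+B = trans (lem₀ (A ÷' B) B) (cong (_+ B) (÷′-*-cancel A B B≢0))
      where lem₀ : ∀ r B → (r + 1ℚ) * B ≡ r * B + B
            lem₀ = solve 2 (λ r B → (r :+ con 1ℚ) :* B := r :* B :+ B) refl
    D≢0 : D ≢ 0ℚ
    D≢0 D≡0 = A+B≢0 (trans (sym D*B≡A+B) (trans (cong (_* B) D≡0) (*-zeroˡ B)))
    lem₁ : ∀ y D B → (1ℚ + y) * (D * B) ≡ D * B + (y * D) * B
    lem₁ = solve 3 (λ y D B → (con 1ℚ :+ y) :* (D :* B) := D :* B :+ (y :* D) :* B) refl
    lem₂ : ∀ A B c → (A + B) + (c - 1ℚ) * B ≡ A + c * B
    lem₂ = solve 3 (λ A B c → (A :+ B) :+ (c :- con 1ℚ) :* B := A :+ c :* B) refl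

  *-nonNeg : ∀ {p q} → 0ℚ ≤ p → 0ℚ ≤ q → 0ℚ ≤ p * q
  *-nonNeg {p} {q} 0≤p 0≤q = nonNegative⁻¹ (p * q) {{nonNeg*nonNeg⇒nonNeg p {{nonNegative 0≤p}} q {{nonNegative 0≤q}}}}

  square-nonNeg : ∀ y → 0ℚ ≤ y * y
  square-nonNeg y with ≤-total 0ℚ y
  ... | inj₁ 0≤y = *-nonNeg 0≤y 0≤y
  ... | inj₂ y≤0 = nonNegative⁻¹ (y * y) {{nonPos*nonPos⇒nonPos y {{nonPositive y≤0}} y {{nonPositive y≤0}}}}

  p≤p+q : ∀ {p q} → 0ℚ ≤ q → p ≤ p + q
  p≤p+q {p} {q} 0≤q = subst (_≤ p + q) (+-identityʳ p) (+-monoʳ-≤ p 0≤q)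

  0≤toℚ : ∀ n → 0ℚ ≤ toℚ n
  0≤toℚ n = toℚ-mono-≤ (z≤n {n})

  4*-mono-≤ : ∀ {p q} → p ≤ q → toℚ 4 * p ≤ toℚ 4 * q
  4*-mono-≤ = *-monoˡ-≤-nonNeg (toℚ 4) {{nonNegative (0≤toℚ 4)}}

  cube[x-e]<a : ∀ x e a → 0ℚ < e → toℚ 4 * (x * x * x) < toℚ 4 * a + e * e * e → cube (x - e) < a
  cube[x-e]<a x e a 0<e 4x³<4a+e³ with cube (x - e) <? a
  ... | yes c<a = c<a
  ... | no  c≮a = ⊥-elim (<-irrefl refl (≤-<-trans 4a+e³≤4x³ 4x³<4a+e³))
    where
    open ≤-Reasoning
    s = (e + e + e) * ((x + x - e) * (x + x - e))
    4a+e³≤4x³ : toℚ 4 * a + e * e * e ≤ toℚ 4 * (x * x * x)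
    4a+e³≤4x³ = begin
      toℚ 4 * a + e * e * e                  ≤⟨ +-monoˡ-≤ (e * e * e) (4*-mono-≤ (≮⇒≥ c≮a)) ⟩
      toℚ 4 * cube (x - e) + e * e * e       ≤⟨ p≤p+q (*-nonNeg (<⇒≤ (+-mono-< (+-mono-< 0<e 0<e) 0<e)) (square-nonNeg (x + x - e))) ⟩
      toℚ 4 * cube (x - e) + e * e * e + s   ≡⟨ identity x e ⟩
      toℚ 4 * (x * x * x)                    ∎
      where
      identity : ∀ x e → toℚ 4 * ((x - e) * (x - e) * (x - e)) + e * e * e + (e + e + e) * ((x + x - e) * (x + x - e))
                         ≡ toℚ 4 * (x * x * x)
      identity = solve 2 (λ x e → con (toℚ 4) :* ((x :- e) :* (x :- e) :* (x :- e)) :+ e :* e :* e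
                                   :+ (e :+ e :+ e) :* ((x :+ x :- e) :* (x :+ x :- e)) := con (toℚ 4) :* (x :* x :* x)) refl

  a<cube[x+e] : ∀ x e a → 0ℚ < e → toℚ 4 * a < toℚ 4 * (x * x * x) + e * e * e → a < cube (x + e)
  a<cube[x+e] x e a 0<e 4a<4x³+e³ with a <? cube (x + e)
  ... | yes a<c = a<c
  ... | no  a≮c = ⊥-elim (<-irrefl refl (≤-<-trans 4x³+e³≤4a 4a<4x³+e³))
    where
    open ≤-Reasoning
    s = (e + e + e) * ((x + x + e) * (x + x + e))
    4x³+e³≤4a : toℚ 4 * (x * x * x) + e * e * e ≤ toℚ 4 * a
    4x³+e³≤4a = begin
      toℚ 4 * (x * x * x) + e * e * e        ≤⟨ p≤p+q (*-nonNeg (<⇒≤ (+-mono-< (+-mono-< 0<e 0<e) 0<e)) (square-nonNeg (x + x + e))) ⟩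
      toℚ 4 * (x * x * x) + e * e * e + s    ≡⟨ identity x e ⟩
      toℚ 4 * cube (x + e)                   ≤⟨ 4*-mono-≤ (≮⇒≥ a≮c) ⟩
      toℚ 4 * a                              ∎
      where
      identity : ∀ x e → toℚ 4 * (x * x * x) + e * e * e + (e + e + e) * ((x + x + e) * (x + x + e))
                         ≡ toℚ 4 * ((x + e) * (x + e) * (x + e))
      identity = solve 2 (λ x e → con (toℚ 4) :* (x :* x :* x) :+ e :* e :* e
                                   :+ (e :+ e :+ e) :* ((x :+ x :+ e) :* (x :+ x :+ e)) := con (toℚ 4) :* ((x :+ e) :* (x :+ e) :* (x :+ e))) refl

  1≤cube : ∀ t → 1ℚ ≤ t → 1ℚ ≤ t * t * t
  1≤cube t 1≤t = begin
    1ℚ * 1ℚ * 1ℚ  ≤⟨ *-monoʳ-≤-nonNeg 1ℚ (*-monoʳ-≤-nonNeg 1ℚ 1≤t) ⟩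
    t * 1ℚ * 1ℚ   ≤⟨ *-monoʳ-≤-nonNeg 1ℚ (*-monoˡ-≤-nonNeg t {{nonNegative 0≤t}} 1≤t) ⟩
    t * t * 1ℚ    ≤⟨ *-monoˡ-≤-nonNeg (t * t) {{nonNegative (*-nonNeg 0≤t 0≤t)}} 1≤t ⟩
    t * t * t     ∎
    where
    open ≤-Reasoning
    0≤t : 0ℚ ≤ t
    0≤t = ≤-trans (0≤toℚ 1) 1≤t

  -- Since W³ ≤ (QW)³ e³ when eQ ≥ 1, dividing by (QW)³ turns the additive W³ into e³.
  unscale : ∀ {e Q W X Y} → 0ℚ ≤ Q → 0ℚ ≤ W → 1ℚ ≤ e * Q →
    Q * Q * Q * (W * W * W) * X < W * W * W + Q * Q * Q * (W * W * W) * Y → X < Y + e * e * e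
  unscale {e} {Q} {W} {X} {Y} 0≤Q 0≤W 1≤eQ KX<W³+KY =
    *-cancelˡ-<-nonNeg K {{nonNegative (*-nonNeg Q³≥0 W³≥0)}} (begin-strict
      K * X                      <⟨ KX<W³+KY ⟩
      W * W * W + K * Y          ≤⟨ +-monoˡ-≤ (K * Y) W³≤Ke³ ⟩
      K * (e * e * e) + K * Y    ≡⟨ solve 3 (λ K Y E → K :* E :+ K :* Y := K :* (Y :+ E)) refl K Y (e * e * e) ⟩
      K * (Y + e * e * e)        ∎)
    where
    open ≤-Reasoning
    K = Q * Q * Q * (W * W * W)
    Q³≥0 = *-nonNeg (*-nonNeg 0≤Q 0≤Q) 0≤Q
    W³≥0 = *-nonNeg (*-nonNeg 0≤W 0≤W) 0≤W
    W³≤Ke³ : W * W * W ≤ K * (e * e * e)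
    W³≤Ke³ = begin
      W * W * W                                ≡⟨ *-identityʳ (W * W * W) ⟨
      W * W * W * 1ℚ                           ≤⟨ *-monoˡ-≤-nonNeg (W * W * W) {{nonNegative W³≥0}} (1≤cube (e * Q) 1≤eQ) ⟩
      W * W * W * ((e * Q) * (e * Q) * (e * Q)) ≡⟨ solve 3 (λ W Q e → W :* W :* W :* ((e :* Q) :* (e :* Q) :* (e :* Q))
                                                           := Q :* Q :* Q :* (W :* W :* W) :* (e :* e :* e)) refl W Q e ⟩
      K * (e * e * e)                          ∎

  cube-bracket : ∀ x a ε W Q → 0ℚ < ε → 0ℚ ≤ Q → 0ℚ ≤ W → 1ℚ ≤ ε * Q →
    let C = toℚ 4 * (Q * Q * Q) in
    C * ((x * W) * (x * W) * (x * W)) < W * W * W + C * (a * (W * W * W)) →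
    C * (a * (W * W * W)) < W * W * W + C * ((x * W) * (x * W) * (x * W)) →
    cube (x - ε) < a × a < cube (x + ε)
  cube-bracket x a ε W Q 0<ε 0≤Q 0≤W 1≤εQ x³-below a-below =
    cube[x-e]<a x ε a 0<ε (unscale {ε} 0≤Q 0≤W 1≤εQ (subst₂ _<_ (scale x) (cong (_+_ (W * W * W)) (scale′ a)) x³-below)) ,
    a<cube[x+e] x ε a 0<ε (unscale {ε} 0≤Q 0≤W 1≤εQ (subst₂ _<_ (scale′ a) (cong (_+_ (W * W * W)) (scale x)) a-below))
    where
    scale : ∀ x → toℚ 4 * (Q * Q * Q) * ((x * W) * (x * W) * (x * W)) ≡ Q * Q * Q * (W * W * W) * (toℚ 4 * (x * x * x))
    scale x = solve 3 (λ x W Q → con (toℚ 4) :* (Q :* Q :* Q) :* ((x :* W) :* (x :* W) :* (x :* W))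
                               := Q :* Q :* Q :* (W :* W :* W) :* (con (toℚ 4) :* (x :* x :* x))) refl x W Q
    scale′ : ∀ a → toℚ 4 * (Q * Q * Q) * (a * (W * W * W)) ≡ Q * Q * Q * (W * W * W) * (toℚ 4 * a)
    scale′ a = solve 3 (λ a W Q → con (toℚ 4) :* (Q :* Q :* Q) :* (a :* (W :* W :* W))
                               := Q :* Q :* Q :* (W :* W :* W) :* (con (toℚ 4) :* a)) refl a W Q

module Convergence where

  open import Data.Nat as ℕ using (suc; _≤_)
  import Data.Nat.Properties as ℕ
  open import Data.Rational using (ℚ; 0ℚ; _+_; _*_; _<_)
  open import Data.Rational.Properties using (<⇒≢)
  open import Data.Product using (_×_; _,_; proj₁; proj₂)
  open import Relation.Binary.PropositionalEquality
  open PowersOf1+θ using (cubeDefectBound)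
  open Approximants
  open RationalBounds

  xSeq-bracket : ∀ {α} → 1 ≤ α → ∀ q m → 4 ℕ.* (q ℕ.* q ℕ.* q) ℕ.* cubeDefectBound α ≤ m →
    let x = xSeq α (suc m)
        W = toℚ (aSeq α (suc m) ℕ.+ bSeq α (suc m))
        C = toℚ 4 * (toℚ q * toℚ q * toℚ q)
    in C * ((x * W) * (x * W) * (x * W)) < W * W * W + C * (toℚ α * (W * W * W)) ×
       C * (toℚ α * (W * W * W)) < W * W * W + C * ((x * W) * (x * W) * (x * W))
  xSeq-bracket {α} 1≤α q m cB≤m =
    subst₂ _<_ (toℚ-c* (U ℕ.* U ℕ.* U) U³≡) (toℚ-V³+c* (α ℕ.* (V ℕ.* V ℕ.* V)) αV³≡) (toℚ-mono-< U-below) ,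
    subst₂ _<_ (toℚ-c* (α ℕ.* (V ℕ.* V ℕ.* V)) αV³≡) (toℚ-V³+c* (U ℕ.* U ℕ.* U) U³≡) (toℚ-mono-< αV-below)
    where
    a = aSeq α (suc m)
    b = bSeq α (suc m)
    U = a ℕ.+ α ℕ.* b
    V = a ℕ.+ b
    x = xSeq α (suc m)
    W = toℚ V
    c = 4 ℕ.* (q ℕ.* q ℕ.* q)
    C = toℚ 4 * (toℚ q * toℚ q * toℚ q)
    bracket = ∣m-n∣-bound c (U ℕ.* U ℕ.* U) (α ℕ.* (V ℕ.* V ℕ.* V)) (V ℕ.* V ℕ.* V) (approximant-cubeDefect 1≤α c m cB≤m)
    U-below = proj₁ bracket
    αV-below = proj₂ bracket
    b-pos = bSeq-pos 1≤α m
    x*W≡U : x * W ≡ toℚ U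
    x*W≡U = begin
      x * toℚ (a ℕ.+ b)                ≡⟨ cong (x *_) (toℚ-+ a b) ⟩
      x * (toℚ a + toℚ b)              ≡⟨ 1+[c-1]÷′[A÷′B+1]*[A+B]≡A+c*B (toℚ a) (toℚ b) (toℚ α)
                                            (λ b≡0 → <⇒≢ (toℚ-mono-< {0} {b} b-pos) (sym b≡0))
                                            (λ a+b≡0 → <⇒≢ (toℚ-mono-< {0} {a ℕ.+ b} (ℕ.<-≤-trans b-pos (ℕ.m≤n+m b a))) (sym (trans (toℚ-+ a b) a+b≡0))) ⟩
      toℚ a + toℚ α * toℚ b            ≡⟨ trans (toℚ-+ a (α ℕ.* b)) (cong (toℚ a +_) (toℚ-* α b)) ⟨
      toℚ U                            ∎
      where open ≡-Reasoning
    U³≡ : toℚ (U ℕ.* U ℕ.* U) ≡ (x * W) * (x * W) * (x * W)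
    U³≡ = trans (toℚ-cube U) (cong (λ y → y * y * y) (sym x*W≡U))
    αV³≡ : toℚ (α ℕ.* (V ℕ.* V ℕ.* V)) ≡ toℚ α * (W * W * W)
    αV³≡ = trans (toℚ-* α (V ℕ.* V ℕ.* V)) (cong (toℚ α *_) (toℚ-cube V))
    toℚ-c* : ∀ n {r} → toℚ n ≡ r → toℚ (c ℕ.* n) ≡ C * r
    toℚ-c* n refl = trans (toℚ-* c n) (cong (_* toℚ n) (trans (toℚ-* 4 (q ℕ.* q ℕ.* q)) (cong (toℚ 4 *_) (toℚ-cube q))))
    toℚ-V³+c* : ∀ n {r} → toℚ n ≡ r → toℚ (V ℕ.* V ℕ.* V ℕ.+ c ℕ.* n) ≡ W * W * W + C * r
    toℚ-V³+c* n n≡r = trans (toℚ-+ (V ℕ.* V ℕ.* V) (c ℕ.* n)) (cong₂ _+_ (toℚ-cube V) (toℚ-c* n n≡r))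

open import Data.Nat as ℕ using (ℕ; _≤_; suc; s≤s)
open import Data.Rational using (ℚ; 0ℚ; _<_; _-_; _+_)
open import Data.Product using (∃-syntax; _×_; _,_)
open PowersOf1+θ using (cubeDefectBound)
open RationalBounds using (archimedean; cube-bracket; 0≤toℚ)
open Convergence using (xSeq-bracket)

corollary3 : (α : ℕ) → 1 ≤ α → (ε : ℚ) → 0ℚ < ε →
    ∃[ N ] ((n : ℕ) → N ≤ n →
    (cube (xSeq α n - ε) < toℚ α) × (toℚ α < cube (xSeq α n + ε)))
corollary3 α 1≤α ε 0<ε =
  let q , 1≤εq = archimedean ε 0<ε in
  suc (4 ℕ.* (q ℕ.* q ℕ.* q) ℕ.* cubeDefectBound α) , λ where
    (suc m) (s≤s cB≤m) →
      let V = aSeq α (suc m) ℕ.+ bSeq α (suc m)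
          x³-below , α-below = xSeq-bracket 1≤α q m cB≤m
      in cube-bracket (xSeq α (suc m)) (toℚ α) ε (toℚ V) (toℚ q) 0<ε (0≤toℚ q) (0≤toℚ V) 1≤εq x³-below α-below
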